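{- Let $n\ge 3$ and $c\ge 1$ be integers and $a\in\{1,\dots,c\}$. Then $$\left|\Pi_n^{eq}\wr C_c(1^a1^a1^a)\right|=\sum_{(p_1,\dots,p_k)\vdash n}\binom{n}{p_1,p_2,\dots,p_k}\prod_{i=1}^n\frac{1}{(\#p(i))!}\prod_{i=1}^k\sum_{\ell_i=0}^2\binom{p_i}{\ell_i}(c-1)^{p_i-\ell_i},$$ where the sum is over all integer partitions $p=(p_1,\dots,p_k)$ of $n$ and $\#p(i)$ is the number of parts equal to $i$.
   Context: $\Pi_n\wr C_c$ is the set of colored set partitions of $[n]$: a set partition of $[n]$ together with a color in $\{1,\dots,c\}$ for each element. A colored partition eq-contains $1^a1^a1^a$ iff some block contains at least three elements of color $a$; $\Pi_n^{eq}\wr C_c(1^a1^a1^a)$ is the set of those that do not. $\binom{n}{p_1,\dots,p_k}=\frac{n!}{p_1!\cdots p_k!}$. -}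

module Defs where

open import Data.Bool using (Bool; true; false; _∧_; _∨_; not; if_then_else_)
open import Data.Nat as ℕ using (ℕ; zero; suc; _∸_; _^_; _!; _<ᵇ_; _≡ᵇ_)
open import Data.Nat.Combinatorics using (_C_)
open import Data.Nat.Properties using (_!≢0)
open import Data.Bool.ListAction as BL using ()
open import Data.Nat.ListAction as NL using ()
open import Data.Fin as Fin using (Fin; toℕ)
open import Data.Fin.Properties using (_≟_)
open import Data.List as List using (List; []; _∷_; map; concatMap; allFin; upTo; length; filter)
open import Data.Vec using (Vec; lookup)
open import Data.Product using (Σ; _×_; _,_)
open import Data.Unit using (⊤)
open import Data.Integer using (+_)
open import Data.Rational as ℚ using (ℚ)
open import Relation.Nullary.Decidable using (⌊_⌋)
open import Data.Bool using (T)

-- A set partition is given by its equivalence relation "same block",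
-- stored as a Boolean n×n matrix (finite data, so distinct partitions
-- are distinct elements).

allF : (n : ℕ) → (Fin n → Bool) → Bool
allF n p = BL.all p (allFin n)

anyF : (n : ℕ) → (Fin n → Bool) → Bool
anyF n p = BL.any p (allFin n)

_⇒ᵇ_ : Bool → Bool → Bool
x ⇒ᵇ y = not x ∨ y

Rel : ℕ → Set
Rel n = Vec (Vec Bool n) n

rel : ∀ {n} → Rel n → Fin n → Fin n → Bool
rel R i j = lookup (lookup R i) j

isEquivᵇ : ∀ {n} → Rel n → Bool
isEquivᵇ {n} R =
  allF n (λ i → rel R i i) ∧
  allF n (λ i → allF n (λ j → rel R i j ⇒ᵇ rel R j i)) ∧
  allF n (λ i → allF n (λ j → allF n (λ k → (rel R i j ∧ rel R j k) ⇒ᵇ rel R i k)))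

-- eq-containment of 1^a 1^a 1^a: some block contains three (distinct)
-- elements of color a.
contains111ᵇ : ∀ {n c} → Rel n → Vec (Fin c) n → Fin c → Bool
contains111ᵇ {n} R col a =
  anyF n (λ i → anyF n (λ j → anyF n (λ k →
    (toℕ i <ᵇ toℕ j) ∧ (toℕ j <ᵇ toℕ k) ∧
    rel R i j ∧ rel R i k ∧
    ⌊ lookup col i ≟ a ⌋ ∧ ⌊ lookup col j ≟ a ⌋ ∧ ⌊ lookup col k ≟ a ⌋)))

ColoredPartition : ℕ → ℕ → Set
ColoredPartition n c = Σ (Rel n × Vec (Fin c) n) (λ { (R , _) → T (isEquivᵇ R) })

AvoidEq111 : (n c : ℕ) → Fin c → Set
AvoidEq111 n c a =
  Σ (Rel n × Vec (Fin c) n)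
    (λ { (R , col) → T (isEquivᵇ R ∧ not (contains111ᵇ R col a)) })

-- Integer partitions of n: nonincreasing lists of positive parts summing
-- to n.  partitionsF fuel n m lists those of n with all parts ≤ m
-- (fuel ≥ n suffices).

partitionsF : ℕ → ℕ → ℕ → List (List ℕ)
partitionsF _        zero    _ = [] ∷ []
partitionsF zero     (suc n) _ = []
partitionsF (suc f) (suc n) m =
  concatMap (λ k → map (suc k ∷_) (partitionsF f (n ∸ k) (suc k)))
            (filter (λ k → suc k ℕ.≤? m) (upTo (suc n)))

partitions : ℕ → List (List ℕ)
partitions n = partitionsF n n n

mult : List ℕ → ℕ → ℕ
mult p i = length (filter (λ x → x ℕ.≟ i) p)

ℕtoℚ : ℕ → ℚ
ℕtoℚ m = + m ℚ./ 1

sumℚ : List ℚ → ℚ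
sumℚ = List.foldr ℚ._+_ ℚ.0ℚ

prodℚ : List ℚ → ℚ
prodℚ = List.foldr ℚ._*_ ℚ.1ℚ

inv! : ℕ → ℚ
inv! m = (+ 1 ℚ./ (m !)) {{m !≢0}}

multinomial : ℕ → List ℕ → ℚ
multinomial n p = ℕtoℚ (n !) ℚ.* prodℚ (map inv! p)

innerSum : ℕ → ℕ → ℕ
innerSum c q = NL.sum (map (λ ℓ → (q C ℓ) ℕ.* ((c ∸ 1) ^ (q ∸ ℓ))) (upTo 3))

rhs : ℕ → ℕ → ℚ
rhs n c = sumℚ (map term (partitions n))
  where
  term : List ℕ → ℚ
  term p = multinomial n p
           ℚ.* prodℚ (map (λ i → inv! (mult p i)) (List.map suc (upTo n)))
           ℚ.* prodℚ (map (λ q → ℕtoℚ (innerSum c q)) p)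

module Submission where

-- Strategy.  (1) Enumeration: a summation operator on finite types whose
-- sums of indicators come with bijections to Fin (FiniteSums) turns
-- AvoidEq111 into Fin N for an explicit sum N = countAvoiding over relation
-- matrices and colourings (Enumeration).  (2) Block recursion: generalising
-- from equivalence relations to partial equivalence relations with a domain
-- mask (PartialEquivalence), we split off the block of the first element of
-- the domain (Containment, MatrixSums, Colourings) and show N = avoiders n,
-- where avoiders (s+1) = Σ_{k+l=s} C(s,k) · W(k+1) · avoiders l and
-- W(q) = atMost q 2 counts the colourings of a q-block with at most two
-- elements of colour a (BlockRecursion).  (3) Exponential formula: the
-- partition sum of the statement is n! · e n, where e n are the coefficients
-- of exp(Σ_q W(q) xᵠ/q!); the derivative identity for e (DerivativeIdentity,
-- ExponentialRecursion) is the same block recursion, so avoiders n = n! · e n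
-- (ClosedForm).

open import Defs
open import Data.Nat using (ℕ; _≤_; zero; suc)
open import Data.Fin using (Fin)
open import Data.Product using (Σ; _×_; _,_)
open import Data.Rational using (ℚ)
open import Function.Bundles using (_↔_)
open import Relation.Binary.PropositionalEquality using (_≡_; trans; cong)

module Booleans where

  open import Data.Bool using (Bool; true; false; _∧_; _∨_; not; T)
  open import Data.Bool.Properties using (T-∧; T-∨; T-≡)
  open import Data.Bool.ListAction as BL using ()
  open import Data.Nat using (ℕ; zero; suc; _*_)
  open import Data.Nat.Properties using (+-identityʳ)
  open import Data.Fin using (Fin; zero; suc)
  open import Data.List using (tabulate)
  open import Data.Product using (_×_; _,_; proj₁; proj₂)
  open import Data.Sum using (_⊎_; inj₁; inj₂)
  open import Data.Empty using (⊥; ⊥-elim)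
  open import Data.Unit using (tt)
  open import Function using (_∘_; id)
  open import Function.Bundles using (Equivalence)
  open import Relation.Binary.PropositionalEquality
  open import Defs using (allF; anyF; _⇒ᵇ_)

  ⟦_⟧ : Bool → ℕ
  ⟦ true ⟧ = 1
  ⟦ false ⟧ = 0

  ⟦∧⟧ : ∀ a b → ⟦ a ∧ b ⟧ ≡ ⟦ a ⟧ * ⟦ b ⟧
  ⟦∧⟧ true b = sym (+-identityʳ ⟦ b ⟧)
  ⟦∧⟧ false b = refl

  ⟦∧⟧₃ : ∀ a b c → ⟦ a ∧ b ∧ c ⟧ ≡ ⟦ a ⟧ * (⟦ b ⟧ * ⟦ c ⟧)
  ⟦∧⟧₃ a b c = trans (⟦∧⟧ a (b ∧ c)) (cong (⟦ a ⟧ *_) (⟦∧⟧ b c))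

  ⟦∧⟧₄ : ∀ a b c d → ⟦ a ∧ b ∧ c ∧ d ⟧ ≡ ⟦ a ⟧ * (⟦ b ⟧ * (⟦ c ⟧ * ⟦ d ⟧))
  ⟦∧⟧₄ a b c d = trans (⟦∧⟧ a (b ∧ c ∧ d)) (cong (⟦ a ⟧ *_) (⟦∧⟧₃ b c d))

  T∧→ : ∀ {a b} → T (a ∧ b) → T a × T b
  T∧→ {a} {b} = Equivalence.to (T-∧ {a} {b})

  →T∧ : ∀ {a b} → T a → T b → T (a ∧ b)
  →T∧ {a} {b} x y = Equivalence.from (T-∧ {a} {b}) (x , y)

  T∨→ : ∀ {a b} → T (a ∨ b) → T a ⊎ T b
  T∨→ {a} {b} = Equivalence.to (T-∨ {a} {b})

  →T∨₁ : ∀ {a b} → T a → T (a ∨ b)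
  →T∨₁ {a} {b} x = Equivalence.from (T-∨ {a} {b}) (inj₁ x)

  →T∨₂ : ∀ {a b} → T b → T (a ∨ b)
  →T∨₂ {a} {b} y = Equivalence.from (T-∨ {a} {b}) (inj₂ y)

  T-true : ∀ {b} → T b → b ≡ true
  T-true {b} = Equivalence.to (T-≡ {b})

  T⇒ : ∀ {a b} → T (a ⇒ᵇ b) → T a → T b
  T⇒ {true} {true} _ _ = tt

  →T⇒ : ∀ {a b} → (T a → T b) → T (a ⇒ᵇ b)
  →T⇒ {true} f = f tt
  →T⇒ {false} f = tt

  Tnot→ : ∀ {a} → T (not a) → T a → ⊥
  Tnot→ {false} _ ()

  →Tnot : ∀ {a} → (T a → ⊥) → T (not a)
  →Tnot {true} f = f tt
  →Tnot {false} f = tt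

  ¬T-false : ∀ {b} → (T b → ⊥) → b ≡ false
  ¬T-false {true} f = ⊥-elim (f tt)
  ¬T-false {false} f = refl

  T-dec : ∀ b → T b ⊎ (T b → ⊥)
  T-dec true = inj₁ tt
  T-dec false = inj₂ (λ ())

  Bool-ext : ∀ {a b : Bool} → (T a → T b) → (T b → T a) → a ≡ b
  Bool-ext {true} {true} f g = refl
  Bool-ext {true} {false} f g = ⊥-elim (f tt)
  Bool-ext {false} {true} f g = ⊥-elim (g tt)
  Bool-ext {false} {false} f g = refl

  -- Bounded quantifiers over Fin n, by recursion on n (so that they unfold
  -- along the decomposition Fin (suc n) = {zero} ∪ suc (Fin n)).
  allᵇ : (n : ℕ) → (Fin n → Bool) → Bool
  allᵇ zero p = true
  allᵇ (suc n) p = p zero ∧ allᵇ n (p ∘ suc)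

  anyᵇ : (n : ℕ) → (Fin n → Bool) → Bool
  anyᵇ zero p = false
  anyᵇ (suc n) p = p zero ∨ anyᵇ n (p ∘ suc)

  allF≡allᵇ : ∀ n p → allF n p ≡ allᵇ n p
  allF≡allᵇ n p = go n id
    where
    go : ∀ k (f : Fin k → Fin n) → BL.all p (tabulate f) ≡ allᵇ k (p ∘ f)
    go zero f = refl
    go (suc k) f = cong (p (f zero) ∧_) (go k (f ∘ suc))

  anyF≡anyᵇ : ∀ n p → anyF n p ≡ anyᵇ n p
  anyF≡anyᵇ n p = go n id
    where
    go : ∀ k (f : Fin k → Fin n) → BL.any p (tabulate f) ≡ anyᵇ k (p ∘ f)
    go zero f = refl
    go (suc k) f = cong (p (f zero) ∨_) (go k (f ∘ suc))

  allᵇ-cong : ∀ n {p q : Fin n → Bool} → (∀ i → p i ≡ q i) → allᵇ n p ≡ allᵇ n q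
  allᵇ-cong zero e = refl
  allᵇ-cong (suc n) e = cong₂ _∧_ (e zero) (allᵇ-cong n (e ∘ suc))

  anyᵇ-cong : ∀ n {p q : Fin n → Bool} → (∀ i → p i ≡ q i) → anyᵇ n p ≡ anyᵇ n q
  anyᵇ-cong zero e = refl
  anyᵇ-cong (suc n) e = cong₂ _∨_ (e zero) (anyᵇ-cong n (e ∘ suc))

  allᵇ→ : ∀ n {p} → T (allᵇ n p) → ∀ i → T (p i)
  allᵇ→ (suc n) h zero = proj₁ (T∧→ h)
  allᵇ→ (suc n) h (suc i) = allᵇ→ n (proj₂ (T∧→ h)) i

  →allᵇ : ∀ n {p} → (∀ i → T (p i)) → T (allᵇ n p)
  →allᵇ zero f = tt
  →allᵇ (suc n) f = →T∧ (f zero) (→allᵇ n (f ∘ suc))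

  anyᵇ-∨ : ∀ n (p q : Fin n → Bool) → anyᵇ n (λ i → p i ∨ q i) ≡ anyᵇ n p ∨ anyᵇ n q
  anyᵇ-∨ zero p q = refl
  anyᵇ-∨ (suc n) p q = trans (cong ((p zero ∨ q zero) ∨_) (anyᵇ-∨ n (p ∘ suc) (q ∘ suc)))
                             (swap (p zero) (q zero) _ _)
    where
    swap : ∀ a b c d → (a ∨ b) ∨ (c ∨ d) ≡ (a ∨ c) ∨ (b ∨ d)
    swap true b c d = refl
    swap false true true d = refl
    swap false true false d = refl
    swap false false c d = refl

  anyᵇ-false : ∀ n → anyᵇ n (λ _ → false) ≡ false
  anyᵇ-false zero = refl
  anyᵇ-false (suc n) = anyᵇ-false n

  allᵇ-true : ∀ n → allᵇ n (λ _ → true) ≡ true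
  allᵇ-true zero = refl
  allᵇ-true (suc n) = allᵇ-true n


module FiniteSums where

  open import Data.Bool using (Bool; true; false)
  open import Data.Nat using (ℕ; zero; suc; _+_; _*_)
  open import Data.Nat.Properties using (*-comm; *-zeroʳ; *-distribˡ-+; +-commutativeSemigroup)
  open import Algebra.Properties.CommutativeSemigroup +-commutativeSemigroup using (interchange)
  open import Data.Fin using (Fin; zero; suc)
  open import Data.Fin.Properties using (+↔⊎)
  open import Data.Vec using (Vec; []; _∷_)
  open import Data.Product using (Σ; _,_)
  open import Data.Product.Function.Dependent.Propositional using (Σ-↔)
  open import Data.Sum using (_⊎_; inj₁; inj₂)
  open import Data.Sum.Function.Propositional using (_⊎-↔_)
  open import Relation.Binary.PropositionalEquality
  open import Function using (_∘_)
  open import Function.Bundles using (_↔_; mk↔ₛ′)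
  open import Function.Properties.Inverse using (↔-refl; ↔-sym)
  open import Function.Construct.Composition using (_↔-∘_)

  Σ-fib : ∀ {A : Set} {B C : A → Set} → (∀ a → B a ↔ C a) → Σ A B ↔ Σ A C
  Σ-fib e = Σ-↔ ↔-refl (e _)

  Σ-Bool : ∀ (P : Bool → Set) → Σ Bool P ↔ (P false ⊎ P true)
  Σ-Bool P = mk↔ₛ′ (λ { (false , p) → inj₁ p ; (true , p) → inj₂ p })
                   (λ { (inj₁ p) → false , p ; (inj₂ p) → true , p })
                   (λ { (inj₁ p) → refl ; (inj₂ p) → refl })
                   (λ { (false , p) → refl ; (true , p) → refl })

  Σ-Fin0 : ∀ (P : Fin 0 → Set) → Σ (Fin 0) P ↔ Fin 0
  Σ-Fin0 P = mk↔ₛ′ (λ { (() , _) }) (λ ()) (λ ()) (λ { (() , _) })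

  Σ-FinS : ∀ {c} (P : Fin (suc c) → Set) → Σ (Fin (suc c)) P ↔ (P zero ⊎ Σ (Fin c) (P ∘ suc))
  Σ-FinS P = mk↔ₛ′ (λ { (zero , p) → inj₁ p ; (suc i , p) → inj₂ (i , p) })
                   (λ { (inj₁ p) → zero , p ; (inj₂ (i , p)) → suc i , p })
                   (λ { (inj₁ p) → refl ; (inj₂ p) → refl })
                   (λ { (zero , p) → refl ; (suc i , p) → refl })

  Σ-Vec0 : ∀ {A : Set} (P : Vec A 0 → Set) → Σ (Vec A 0) P ↔ P []
  Σ-Vec0 P = mk↔ₛ′ (λ { ([] , p) → p }) (λ p → [] , p) (λ _ → refl) (λ { ([] , p) → refl })

  Σ-VecS : ∀ {A : Set} {n} (P : Vec A (suc n) → Set)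
         → Σ (Vec A (suc n)) P ↔ Σ A (λ a → Σ (Vec A n) (λ v → P (a ∷ v)))
  Σ-VecS P = mk↔ₛ′ (λ { (a ∷ v , p) → a , v , p }) (λ { (a , v , p) → a ∷ v , p })
                   (λ _ → refl) (λ { (a ∷ v , p) → refl })

  Fin+ : ∀ m n → (Fin m ⊎ Fin n) ↔ Fin (m + n)
  Fin+ m n = ↔-sym (+↔⊎ {m} {n})

  -- A summation operator on a finite type A: additive, homogeneous, and
  -- counting, i.e. Σ_{x:A} Fin (f x) is in bijection with Fin (∑ f).
  -- Sums of indicators therefore count the elements satisfying a predicate.
  record Summable (A : Set) : Set₁ where
    field
      ∑ : (A → ℕ) → ℕ
      ∑-cong : ∀ {f g} → (∀ x → f x ≡ g x) → ∑ f ≡ ∑ g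
      ∑-+ : ∀ f g → ∑ (λ x → f x + g x) ≡ ∑ f + ∑ g
      ∑-*ˡ : ∀ k f → ∑ (λ x → k * f x) ≡ k * ∑ f
      ∑-↔ : ∀ f → Σ A (λ x → Fin (f x)) ↔ Fin (∑ f)

    ∑-0 : ∑ (λ _ → 0) ≡ 0
    ∑-0 = ∑-*ˡ 0 (λ _ → 0)

    ∑-*ʳ : ∀ k f → ∑ (λ x → f x * k) ≡ ∑ f * k
    ∑-*ʳ k f = trans (∑-cong (λ x → *-comm (f x) k)) (trans (∑-*ˡ k f) (*-comm k (∑ f)))

  open Summable public

  ΣB : (Bool → ℕ) → ℕ
  ΣB f = f false + f true

  SmB : Summable Bool
  SmB = record
    { ∑ = ΣB
    ; ∑-cong = λ e → cong₂ _+_ (e false) (e true)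
    ; ∑-+ = λ f g → interchange (f false) (g false) (f true) (g true)
    ; ∑-*ˡ = λ k f → sym (*-distribˡ-+ k (f false) (f true))
    ; ∑-↔ = λ f → Fin+ (f false) (f true) ↔-∘ Σ-Bool (λ b → Fin (f b))
    }

  ΣF : (c : ℕ) → (Fin c → ℕ) → ℕ
  ΣF zero f = 0
  ΣF (suc c) f = f zero + ΣF c (f ∘ suc)

  SmF : ∀ c → Summable (Fin c)
  SmF c = record { ∑ = ΣF c ; ∑-cong = cg c ; ∑-+ = ad c ; ∑-*ˡ = sc c ; ∑-↔ = is c }
    where
    cg : ∀ c {f g} → (∀ x → f x ≡ g x) → ΣF c f ≡ ΣF c g
    cg zero e = refl
    cg (suc c) e = cong₂ _+_ (e zero) (cg c (e ∘ suc))
    ad : ∀ c f g → ΣF c (λ x → f x + g x) ≡ ΣF c f + ΣF c g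
    ad zero f g = refl
    ad (suc c) f g = trans (cong (f zero + g zero +_) (ad c (f ∘ suc) (g ∘ suc))) (interchange (f zero) (g zero) _ _)
    sc : ∀ c k f → ΣF c (λ x → k * f x) ≡ k * ΣF c f
    sc zero k f = sym (*-zeroʳ k)
    sc (suc c) k f = trans (cong (k * f zero +_) (sc c k (f ∘ suc))) (sym (*-distribˡ-+ k (f zero) _))
    is : ∀ c f → Σ (Fin c) (λ x → Fin (f x)) ↔ Fin (ΣF c f)
    is zero f = Σ-Fin0 _
    is (suc c) f = Fin+ _ _ ↔-∘ ((↔-refl ⊎-↔ is c (f ∘ suc)) ↔-∘ Σ-FinS _)

  ΣV : ∀ {A : Set} → Summable A → (n : ℕ) → (Vec A n → ℕ) → ℕ
  ΣV SA zero f = f []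
  ΣV SA (suc n) f = ∑ SA (λ a → ΣV SA n (λ v → f (a ∷ v)))

  SmV : ∀ {A : Set} → Summable A → ∀ n → Summable (Vec A n)
  SmV {A} SA n = record { ∑ = ΣV SA n ; ∑-cong = cg n ; ∑-+ = ad n ; ∑-*ˡ = sc n ; ∑-↔ = is n }
    where
    cg : ∀ n {f g} → (∀ x → f x ≡ g x) → ΣV SA n f ≡ ΣV SA n g
    cg zero e = e []
    cg (suc n) e = ∑-cong SA (λ a → cg n (λ v → e (a ∷ v)))
    ad : ∀ n f g → ΣV SA n (λ x → f x + g x) ≡ ΣV SA n f + ΣV SA n g
    ad zero f g = refl
    ad (suc n) f g = trans (∑-cong SA (λ a → ad n _ _)) (∑-+ SA _ _)
    sc : ∀ n k f → ΣV SA n (λ x → k * f x) ≡ k * ΣV SA n f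
    sc zero k f = refl
    sc (suc n) k f = trans (∑-cong SA (λ a → sc n k _)) (∑-*ˡ SA k _)
    is : ∀ n f → Σ (Vec A n) (λ x → Fin (f x)) ↔ Fin (ΣV SA n f)
    is zero f = Σ-Vec0 _
    is (suc n) f = ∑-↔ SA _ ↔-∘ (Σ-fib (λ a → is n (λ v → f (a ∷ v))) ↔-∘ Σ-VecS _)

  FubB : ∀ {B : Set} (SB : Summable B) (h : Bool → B → ℕ)
       → ΣB (λ x → ∑ SB (h x)) ≡ ∑ SB (λ y → ΣB (λ x → h x y))
  FubB SB h = sym (∑-+ SB _ _)

  FubF : ∀ {B : Set} (SB : Summable B) c (h : Fin c → B → ℕ)
       → ΣF c (λ x → ∑ SB (h x)) ≡ ∑ SB (λ y → ΣF c (λ x → h x y))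
  FubF SB zero h = sym (∑-0 SB)
  FubF SB (suc c) h = trans (cong (∑ SB (h zero) +_) (FubF SB c (h ∘ suc))) (sym (∑-+ SB _ _))

  FubV : ∀ {A B : Set} (SA : Summable A) (SB : Summable B)
       → (∀ (h : A → B → ℕ) → ∑ SA (λ x → ∑ SB (h x)) ≡ ∑ SB (λ y → ∑ SA (λ x → h x y)))
       → ∀ n (h : Vec A n → B → ℕ) → ΣV SA n (λ x → ∑ SB (h x)) ≡ ∑ SB (λ y → ΣV SA n (λ x → h x y))
  FubV SA SB fa zero h = refl
  FubV SA SB fa (suc n) h = trans (∑-cong SA (λ a → FubV SA SB fa n (λ v → h (a ∷ v)))) (fa _)


module PartialEquivalence where

  open import Data.Bool using (Bool; true; false; _∧_; _∨_; not; T; _xor_)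
  open import Data.Nat using (ℕ; zero; suc)
  open import Data.Fin using (Fin; zero; suc)
  open import Data.Product using (_×_; _,_; proj₁; proj₂)
  open import Data.Sum using (inj₁; inj₂)
  open import Data.Empty using (⊥; ⊥-elim)
  open import Data.Unit using (tt)
  open import Relation.Binary.PropositionalEquality
  open import Defs using (_⇒ᵇ_)
  open Booleans

  -- A set partition of a subset m ⊆ [n] is a partial equivalence relation
  -- (PER) whose domain is exactly m.  Removing the block of the least element
  -- leaves a PER on a smaller domain, which is what the block recursion of
  -- the count needs; hence all counting below is done for PERs with a mask.
  Mask : ℕ → Set
  Mask n = Fin n → Bool

  BoolRel : ℕ → Set
  BoolRel n = Fin n → Fin n → Bool

  domF : ∀ n → Mask n → BoolRel n → Bool
  domF n m r = allᵇ n (λ i → allᵇ n (λ j → r i j ⇒ᵇ m i))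
  reflF : ∀ n → Mask n → BoolRel n → Bool
  reflF n m r = allᵇ n (λ i → m i ⇒ᵇ r i i)
  symF : ∀ n → BoolRel n → Bool
  symF n r = allᵇ n (λ i → allᵇ n (λ j → r i j ⇒ᵇ r j i))
  transF : ∀ n → BoolRel n → Bool
  transF n r = allᵇ n (λ i → allᵇ n (λ j → allᵇ n (λ k → (r i j ∧ r j k) ⇒ᵇ r i k)))

  isPERᵇ : ∀ n → Mask n → BoolRel n → Bool
  isPERᵇ n m r = domF n m r ∧ reflF n m r ∧ symF n r ∧ transF n r

  record IsPER (n : ℕ) (m : Mask n) (r : BoolRel n) : Set where
    field
      dom : ∀ i j → T (r i j) → T (m i)
      rfl : ∀ i → T (m i) → T (r i i)
      sy : ∀ i j → T (r i j) → T (r j i)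
      tr : ∀ i j k → T (r i j) → T (r j k) → T (r i k)
  open IsPER public

  isPERᵇ-sound : ∀ n {m r} → T (isPERᵇ n m r) → IsPER n m r
  isPERᵇ-sound n {m} {r} h = record
    { dom = λ i j x → T⇒ (allᵇ→ n (allᵇ→ n (proj₁ h1) i) j) x
    ; rfl = λ i x → T⇒ (allᵇ→ n (proj₁ h2) i) x
    ; sy = λ i j x → T⇒ (allᵇ→ n (allᵇ→ n (proj₁ h3) i) j) x
    ; tr = λ i j k x y → T⇒ (allᵇ→ n (allᵇ→ n (allᵇ→ n (proj₂ h3) i) j) k) (→T∧ x y) }
    where
    h1 = T∧→ {domF n m r} h
    h2 = T∧→ {reflF n m r} (proj₂ h1)
    h3 = T∧→ {symF n r} (proj₂ h2)

  isPERᵇ-complete : ∀ n {m r} → IsPER n m r → T (isPERᵇ n m r)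
  isPERᵇ-complete n {m} {r} P =
    →T∧ (→allᵇ n (λ i → →allᵇ n (λ j → →T⇒ (dom P i j))))
    (→T∧ (→allᵇ n (λ i → →T⇒ (rfl P i)))
    (→T∧ (→allᵇ n (λ i → →allᵇ n (λ j → →T⇒ (sy P i j))))
         (→allᵇ n (λ i → →allᵇ n (λ j → →allᵇ n (λ k → →T⇒ (λ x → tr P i j k (proj₁ (T∧→ x)) (proj₂ (T∧→ x)))))))))

  IsPER-cong : ∀ n {m m' r r'} → (∀ i → m i ≡ m' i) → (∀ i j → r i j ≡ r' i j) → IsPER n m r → IsPER n m' r'
  IsPER-cong n {m} {m'} {r} {r'} em er P = record
    { dom = λ i j x → subst T (em i) (dom P i j (subst T (sym (er i j)) x))
    ; rfl = λ i x → subst T (er i i) (rfl P i (subst T (sym (em i)) x))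
    ; sy = λ i j x → subst T (er j i) (sy P i j (subst T (sym (er i j)) x))
    ; tr = λ i j k x y → subst T (er i k) (tr P i j k (subst T (sym (er i j)) x) (subst T (sym (er j k)) y)) }

  isPERᵇ-cong : ∀ n {m m' r r'} → (∀ i → m i ≡ m' i) → (∀ i j → r i j ≡ r' i j) → isPERᵇ n m r ≡ isPERᵇ n m' r'
  isPERᵇ-cong n em er = Bool-ext (λ h → isPERᵇ-complete n (IsPER-cong n em er (isPERᵇ-sound n h)))
                              (λ h → isPERᵇ-complete n (IsPER-cong n (λ i → sym (em i)) (λ i j → sym (er i j)) (isPERᵇ-sound n h)))

  xor-tt : ∀ a b → T b → T (a xor b) → T a → ⊥
  xor-tt true true _ () _
  xor-tf : ∀ a b → (T b → ⊥) → T (a xor b) → T a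
  xor-tf true false _ _ = tt
  xor-tf false true nb _ = ⊥-elim (nb tt)
  xor-tf true true nb _ = ⊥-elim (nb tt)

  blockUnion : ∀ n (m s : Mask n) (q : BoolRel n) → (∀ i → T (s i) → T (m i))
             → IsPER n (λ i → m i ∧ not (s i)) q
             → IsPER n m (λ i j → (s i ∧ s j) ∨ q i j)
  blockUnion n m s q sub P = record { dom = dm ; rfl = rf ; sy = sy' ; tr = tr' }
    where
    qdom : ∀ i j → T (q i j) → T (s i) → ⊥
    qdom i j x si = Tnot→ {s i} (proj₂ (T∧→ {m i} (dom P i j x))) si
    qdom' : ∀ i j → T (q i j) → T (s j) → ⊥
    qdom' i j x sj = qdom j i (sy P i j x) sj
    dm : ∀ i j → T ((s i ∧ s j) ∨ q i j) → T (m i)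
    dm i j x with T∨→ {s i ∧ s j} x
    ... | inj₁ y = sub i (proj₁ (T∧→ y))
    ... | inj₂ y = proj₁ (T∧→ {m i} (dom P i j y))
    rf : ∀ i → T (m i) → T ((s i ∧ s i) ∨ q i i)
    rf i mi with T-dec (s i)
    ... | inj₁ si = →T∨₁ {s i ∧ s i} (→T∧ si si)
    ... | inj₂ nsi = →T∨₂ {s i ∧ s i} (rfl P i (→T∧ mi (→Tnot nsi)))
    sy' : ∀ i j → T ((s i ∧ s j) ∨ q i j) → T ((s j ∧ s i) ∨ q j i)
    sy' i j x with T∨→ {s i ∧ s j} x
    ... | inj₁ y = →T∨₁ {s j ∧ s i} (→T∧ {s j} {s i} (proj₂ (T∧→ {s i} y)) (proj₁ (T∧→ {s i} y)))
    ... | inj₂ y = →T∨₂ {s j ∧ s i} (sy P i j y)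
    tr' : ∀ i j k → T ((s i ∧ s j) ∨ q i j) → T ((s j ∧ s k) ∨ q j k) → T ((s i ∧ s k) ∨ q i k)
    tr' i j k x y with T∨→ {s i ∧ s j} x | T∨→ {s j ∧ s k} y
    ... | inj₁ a | inj₁ b = →T∨₁ {s i ∧ s k} (→T∧ {s i} {s k} (proj₁ (T∧→ {s i} a)) (proj₂ (T∧→ {s j} b)))
    ... | inj₁ a | inj₂ b = ⊥-elim (qdom j k b (proj₂ (T∧→ a)))
    ... | inj₂ a | inj₁ b = ⊥-elim (qdom' i j a (proj₁ (T∧→ b)))
    ... | inj₂ a | inj₂ b = →T∨₂ {s i ∧ s k} (tr P i j k a b)

  blockSplit : ∀ n (m s : Mask n) (p : BoolRel n) → IsPER n m p
             → (∀ i j → T (s i) → T (s j) → T (p i j))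
             → (∀ i j → T (s i) → T (p i j) → T (s j))
             → IsPER n (λ i → m i ∧ not (s i)) (λ i j → p i j xor (s i ∧ s j))
  blockSplit n m s p P cmp cls = record { dom = dm ; rfl = rf ; sy = sy' ; tr = tr' }
    where
    key : ∀ i j → T (p i j xor (s i ∧ s j)) → (T (s i) → ⊥) × T (p i j)
    key i j x with T-dec (s i) | T-dec (s j)
    ... | inj₁ si | inj₁ sj = ⊥-elim (xor-tt (p i j) (s i ∧ s j) (→T∧ si sj) x (cmp i j si sj))
    ... | inj₁ si | inj₂ nsj = ⊥-elim (nsj (cls i j si (xor-tf (p i j) (s i ∧ s j) (λ z → nsj (proj₂ (T∧→ {s i} z))) x)))
    ... | inj₂ nsi | _ = nsi , xor-tf (p i j) (s i ∧ s j) (λ z → nsi (proj₁ (T∧→ {s i} z))) x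
    back : ∀ i j → (T (s i) → ⊥) → T (p i j) → T (p i j xor (s i ∧ s j))
    back i j nsi pij rewrite ¬T-false nsi | T-true pij = tt
    dm : ∀ i j → T (p i j xor (s i ∧ s j)) → T (m i ∧ not (s i))
    dm i j x = →T∧ (dom P i j (proj₂ (key i j x))) (→Tnot (proj₁ (key i j x)))
    rf : ∀ i → T (m i ∧ not (s i)) → T (p i i xor (s i ∧ s i))
    rf i x = back i i (Tnot→ (proj₂ (T∧→ {m i} x))) (rfl P i (proj₁ (T∧→ {m i} x)))
    nsj : ∀ i j → T (p i j xor (s i ∧ s j)) → T (s j) → ⊥
    nsj i j x sj = proj₁ (key i j x) (cls j i sj (sy P i j (proj₂ (key i j x))))
    sy' : ∀ i j → T (p i j xor (s i ∧ s j)) → T (p j i xor (s j ∧ s i))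
    sy' i j x = back j i (nsj i j x) (sy P i j (proj₂ (key i j x)))
    tr' : ∀ i j k → T (p i j xor (s i ∧ s j)) → T (p j k xor (s j ∧ s k)) → T (p i k xor (s i ∧ s k))
    tr' i j k x y = back i k (proj₁ (key i j x)) (tr P i j k (proj₂ (key i j x)) (proj₂ (key j k y)))

  maskCons : ∀ {n} → Bool → Mask n → Mask (suc n)
  maskCons b m zero = b
  maskCons b m (suc i) = m i

  bordered : ∀ {n} → Bool → (Fin n → Bool) → (Fin n → Bool) → BoolRel n → BoolRel (suc n)
  bordered x row cm r zero zero = x
  bordered x row cm r zero (suc j) = row j
  bordered x row cm r (suc i) zero = cm i
  bordered x row cm r (suc i) (suc j) = r i j

  restrict : ∀ n {m r} → IsPER (suc n) m r → IsPER n (λ i → m (suc i)) (λ i j → r (suc i) (suc j))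
  restrict n P = record
    { dom = λ i j → dom P (suc i) (suc j)
    ; rfl = λ i → rfl P (suc i)
    ; sy = λ i j → sy P (suc i) (suc j)
    ; tr = λ i j k → tr P (suc i) (suc j) (suc k) }

  extend : ∀ n {m r} → IsPER n m r → IsPER (suc n) (maskCons false m) (bordered false (λ _ → false) (λ _ → false) r)
  extend n {m} {r} P = record { dom = dm ; rfl = rf ; sy = sy' ; tr = tr' }
    where
    R = bordered false (λ _ → false) (λ _ → false) r
    dm : ∀ i j → T (R i j) → T (maskCons false m i)
    dm zero zero ()
    dm zero (suc j) ()
    dm (suc i) zero ()
    dm (suc i) (suc j) x = dom P i j x
    rf : ∀ i → T (maskCons false m i) → T (R i i)
    rf (suc i) x = rfl P i x
    sy' : ∀ i j → T (R i j) → T (R j i)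
    sy' zero zero ()
    sy' zero (suc j) ()
    sy' (suc i) zero ()
    sy' (suc i) (suc j) x = sy P i j x
    tr' : ∀ i j k → T (R i j) → T (R j k) → T (R i k)
    tr' zero zero _ () _
    tr' zero (suc j) _ () _
    tr' (suc i) zero _ () _
    tr' (suc i) (suc j) zero x ()
    tr' (suc i) (suc j) (suc k) x y = tr P i j k x y

  sameᵇ : Bool → Bool → Bool
  sameᵇ true b = b
  sameᵇ false b = not b

  sameᵇ→ : ∀ a b → T (sameᵇ a b) → a ≡ b
  sameᵇ→ true true _ = refl
  sameᵇ→ false false _ = refl

  →sameᵇ : ∀ a b → a ≡ b → T (sameᵇ a b)
  →sameᵇ true true _ = tt
  →sameᵇ false false _ = tt

  outside→ : ∀ n {m' x row cm r'} → IsPER (suc n) (maskCons false m') (bordered x row cm r')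
    → T (not x) × T (allᵇ n (λ j → not (row j))) × T (allᵇ n (λ j → not (cm j))) × IsPER n m' r'
  outside→ n {m'} {x} {row} {cm} {r'} P =
    →Tnot (λ h → dom P zero zero h) ,
    →allᵇ n (λ j → →Tnot (λ h → dom P zero (suc j) h)) ,
    →allᵇ n (λ j → →Tnot (λ h → dom P zero (suc j) (sy P (suc j) zero h))) ,
    restrict n P

  outside← : ∀ n {m' x row cm r'} → T (not x) → T (allᵇ n (λ j → not (row j))) → T (allᵇ n (λ j → not (cm j))) → IsPER n m' r'
    → IsPER (suc n) (maskCons false m') (bordered x row cm r')
  outside← n {m'} {x} {row} {cm} {r'} hx hr hc P = IsPER-cong (suc n) em er (extend n P)
    where
    em : ∀ i → maskCons false m' i ≡ maskCons false m' i
    em i = refl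
    er : ∀ i j → bordered false (λ _ → false) (λ _ → false) r' i j ≡ bordered x row cm r' i j
    er zero zero = sym (¬T-false (Tnot→ hx))
    er zero (suc j) = sym (¬T-false (Tnot→ (allᵇ→ n hr j)))
    er (suc i) zero = sym (¬T-false (Tnot→ (allᵇ→ n hc i)))
    er (suc i) (suc j) = refl

  isPERᵇ-outside : ∀ n m' x row cm r' → isPERᵇ (suc n) (maskCons false m') (bordered x row cm r')
           ≡ not x ∧ allᵇ n (λ j → not (row j)) ∧ allᵇ n (λ j → not (cm j)) ∧ isPERᵇ n m' r'
  isPERᵇ-outside n m' x row cm r' = Bool-ext
    (λ h → let (a , b , c , d) = outside→ n {m'} {x} {row} {cm} {r'} (isPERᵇ-sound (suc n) h) in →T∧ {not x} a (→T∧ {allᵇ n (λ j → not (row j))} b (→T∧ {allᵇ n (λ j → not (cm j))} c (isPERᵇ-complete n d))))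
    (λ h → let h1 = T∧→ {not x} h ; h2 = T∧→ {allᵇ n (λ j → not (row j))} (proj₂ h1) ; h3 = T∧→ {allᵇ n (λ j → not (cm j))} (proj₂ h2)
           in isPERᵇ-complete (suc n) (outside← n (proj₁ h1) (proj₁ h2) (proj₁ h3) (isPERᵇ-sound n (proj₂ h3))))

  inside→ : ∀ n {m' x row cm r'} → IsPER (suc n) (maskCons true m') (bordered x row cm r')
    → T x × T (allᵇ n (λ j → sameᵇ (row j) (cm j))) × T (allᵇ n (λ j → row j ⇒ᵇ m' j))
      × IsPER n (λ i → m' i ∧ not (row i)) (λ i j → r' i j xor (row i ∧ row j))
  inside→ n {m'} {x} {row} {cm} {r'} P =
    rfl P zero tt ,
    →allᵇ n (λ j → →sameᵇ (row j) (cm j) (Bool-ext (λ h → sy P zero (suc j) h) (λ h → sy P (suc j) zero h))) ,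
    →allᵇ n (λ j → →T⇒ (λ h → dom P (suc j) zero (sy P zero (suc j) h))) ,
    restrict n Q
    where
    R = bordered x row cm r'
    s : Mask (suc n)
    s j = R zero j
    cmp : ∀ i j → T (s i) → T (s j) → T (R i j)
    cmp i j si sj = tr P i zero j (sy P zero i si) sj
    cls : ∀ i j → T (s i) → T (R i j) → T (s j)
    cls i j si rij = tr P zero i j si rij
    Q : IsPER (suc n) (λ i → maskCons true m' i ∧ not (s i)) (λ i j → R i j xor (s i ∧ s j))
    Q = blockSplit (suc n) (maskCons true m') s R P cmp cls

  inside← : ∀ n {m' x row cm r'} → T x → T (allᵇ n (λ j → sameᵇ (row j) (cm j))) → T (allᵇ n (λ j → row j ⇒ᵇ m' j))
      → IsPER n (λ i → m' i ∧ not (row i)) (λ i j → r' i j xor (row i ∧ row j))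
      → IsPER (suc n) (maskCons true m') (bordered x row cm r')
  inside← n {m'} {x} {row} {cm} {r'} hx he hs P = IsPER-cong (suc n) (λ _ → refl) er U
    where
    r'' : BoolRel n
    r'' i j = r' i j xor (row i ∧ row j)
    s : Mask (suc n)
    s = maskCons true row
    E = extend n P
    U : IsPER (suc n) (maskCons true m') (λ i j → (s i ∧ s j) ∨ bordered false (λ _ → false) (λ _ → false) r'' i j)
    U = blockUnion (suc n) (maskCons true m') s _ sb (IsPER-cong (suc n) em (λ _ _ → refl) E)
      where
      sb : ∀ i → T (s i) → T (maskCons true m' i)
      sb zero _ = tt
      sb (suc i) h = T⇒ (allᵇ→ n hs i) h
      em : ∀ i → maskCons false (λ i → m' i ∧ not (row i)) i ≡ maskCons true m' i ∧ not (s i)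
      em zero = refl
      em (suc i) = refl
    er : ∀ i j → ((s i ∧ s j) ∨ bordered false (λ _ → false) (λ _ → false) r'' i j) ≡ bordered x row cm r' i j
    er zero zero = sym (T-true hx)
    er zero (suc j) = lem (row j)
      where lem : ∀ b → (b ∨ false) ≡ b
            lem true = refl
            lem false = refl
    er (suc i) zero = trans (lem (row i)) (sameᵇ→ _ _ (allᵇ→ n he i))
      where lem : ∀ b → ((b ∧ true) ∨ false) ≡ b
            lem true = refl
            lem false = refl
    er (suc i) (suc j) = lem (r' i j) (row i ∧ row j) (λ b h → Tnot→ (proj₂ (T∧→ {m' i} (dom P i j h))) (proj₁ (T∧→ {row i} b)))
      where
      lem : ∀ a b → (T b → T (a xor b) → ⊥) → (b ∨ (a xor b)) ≡ a
      lem true true f = refl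
      lem false true f = ⊥-elim (f tt tt)
      lem a false f = lem2 a
        where lem2 : ∀ a → (a xor false) ≡ a
              lem2 true = refl
              lem2 false = refl

  isPERᵇ-inside : ∀ n m' x row cm r' → isPERᵇ (suc n) (maskCons true m') (bordered x row cm r')
          ≡ x ∧ allᵇ n (λ j → sameᵇ (row j) (cm j)) ∧ allᵇ n (λ j → row j ⇒ᵇ m' j)
            ∧ isPERᵇ n (λ i → m' i ∧ not (row i)) (λ i j → r' i j xor (row i ∧ row j))
  isPERᵇ-inside n m' x row cm r' = Bool-ext
    (λ h → let (a , b , c , d) = inside→ n {m'} {x} {row} {cm} {r'} (isPERᵇ-sound (suc n) h) in →T∧ {x} a (→T∧ {allᵇ n (λ j → sameᵇ (row j) (cm j))} b (→T∧ {allᵇ n (λ j → row j ⇒ᵇ m' j)} c (isPERᵇ-complete n d))))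
    (λ h → let h1 = T∧→ {x} h ; h2 = T∧→ {allᵇ n (λ j → sameᵇ (row j) (cm j))} (proj₂ h1) ; h3 = T∧→ {allᵇ n (λ j → row j ⇒ᵇ m' j)} (proj₂ h2)
           in isPERᵇ-complete (suc n) (inside← n (proj₁ h1) (proj₁ h2) (proj₁ h3) (isPERᵇ-sound n (proj₂ h3))))


module Containment where

  open import Data.Bool using (Bool; true; false; _∧_; _∨_; T; _xor_)
  open import Data.Bool.Properties using (∧-identityʳ; ∧-zeroʳ; xor-identityʳ)
  open import Data.Bool.Solver using (module ∨-∧-Solver)
  open import Data.Nat using (ℕ; zero; suc; _<ᵇ_)
  open import Data.Fin using (Fin; zero; suc; toℕ)
  open import Data.Product using (_×_; _,_; proj₁; proj₂)
  open import Data.Sum using (inj₁; inj₂)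
  open import Data.Empty using (⊥)
  open import Relation.Binary.PropositionalEquality
  open import Function using (_∘_)
  open Booleans
  open PartialEquivalence
  open ∨-∧-Solver using (solve; _:+_; _:*_; _:=_; con)

  lt : ∀ {n} → Fin n → Fin n → Bool
  lt i j = toℕ i <ᵇ toℕ j

  containsF : ∀ n → BoolRel n → (Fin n → Bool) → Bool
  containsF n r α = anyᵇ n (λ i → anyᵇ n (λ j → anyᵇ n (λ k → lt i j ∧ lt j k ∧ r i j ∧ r i k ∧ α i ∧ α j ∧ α k)))

  -- Pk r n u: at least r of the booleans u 0, …, u (n-1) are true.  The
  -- pattern test within one block is "at least three marked elements".
  Pk : ℕ → (n : ℕ) → (Fin n → Bool) → Bool
  Pk zero n u = true
  Pk (suc r) zero u = false
  Pk (suc r) (suc n) u = (u zero ∧ Pk r n (u ∘ suc)) ∨ Pk (suc r) n (u ∘ suc)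

  P2F : ∀ n → (Fin n → Bool) → Bool
  P2F n v = anyᵇ n (λ j → anyᵇ n (λ k → lt j k ∧ v j ∧ v k))

  T3F : ∀ n → (Fin n → Bool) → Bool
  T3F n v = anyᵇ n (λ i → anyᵇ n (λ j → anyᵇ n (λ k → lt i j ∧ lt j k ∧ v i ∧ v j ∧ v k)))

  anyᵇ-∧ˡ : ∀ n a (p : Fin n → Bool) → anyᵇ n (λ i → a ∧ p i) ≡ a ∧ anyᵇ n p
  anyᵇ-∧ˡ n true p = refl
  anyᵇ-∧ˡ n false p = anyᵇ-false n

  -- An index i is never below 0, so every quantified triple starting with a
  -- later index than 0 at position "0 < ·" contributes nothing; these two
  -- facts drop the summands of anyᵇ (suc n) that test lt (suc i) zero.
  dropZero : ∀ n x → (anyᵇ n (λ _ → false) ∨ x) ≡ x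
  dropZero n x = cong (_∨ x) (anyᵇ-false n)

  false∧∨ : ∀ a c → ((a ∧ false) ∨ c) ≡ c
  false∧∨ a c = cong (_∨ c) (∧-zeroʳ a)

  Pk1 : ∀ n u → Pk 1 n u ≡ anyᵇ n u
  Pk1 zero u = refl
  Pk1 (suc n) u = cong₂ _∨_ (∧-identityʳ (u zero)) (Pk1 n (u ∘ suc))

  Pk2 : ∀ n v → P2F n v ≡ Pk 2 n v
  Pk2 zero v = refl
  Pk2 (suc n) v = cong₂ _∨_ (trans (anyᵇ-∧ˡ n (v zero) (v ∘ suc)) (cong (v zero ∧_) (sym (Pk1 n _))))
                            (Pk2 n (v ∘ suc))

  T3F-suc : ∀ n v → T3F (suc n) v ≡ (v zero ∧ P2F n (v ∘ suc)) ∨ T3F n (v ∘ suc)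
  T3F-suc n v = cong₂ _∨_ first (anyᵇ-cong n (λ i → trans (dropZero n _) (anyᵇ-cong n (λ j → false∧∨ (lt i j) _))))
    where
    reorder : ∀ v0 l a b → (l ∧ v0 ∧ a ∧ b) ≡ (v0 ∧ (l ∧ a ∧ b))
    reorder = solve 4 (λ v0 l a b → l :* (v0 :* (a :* b)) := v0 :* (l :* (a :* b))) refl
    first : (anyᵇ n (λ _ → false) ∨ anyᵇ n (λ j → anyᵇ n (λ k → lt j k ∧ v zero ∧ v (suc j) ∧ v (suc k))))
            ≡ v zero ∧ P2F n (v ∘ suc)
    first = trans (dropZero n _)
                  (trans (anyᵇ-cong n (λ j → trans (anyᵇ-cong n (λ k → reorder (v zero) (lt j k) (v (suc j)) (v (suc k)))) (anyᵇ-∧ˡ n (v zero) _)))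
                         (anyᵇ-∧ˡ n (v zero) _))

  Pk3 : ∀ n v → T3F n v ≡ Pk 3 n v
  Pk3 zero v = refl
  Pk3 (suc n) v = trans (T3F-suc n v) (cong₂ _∨_ (cong (v zero ∧_) (Pk2 n _)) (Pk3 n _))

  Pk-cong : ∀ r n {u v : Fin n → Bool} → (∀ i → u i ≡ v i) → Pk r n u ≡ Pk r n v
  Pk-cong zero n e = refl
  Pk-cong (suc r) zero e = refl
  Pk-cong (suc r) (suc n) e = cong₂ _∨_ (cong₂ _∧_ (e zero) (Pk-cong r n (e ∘ suc))) (Pk-cong (suc r) n (e ∘ suc))

  Pk-mono : ∀ r n u → T (Pk (suc r) n u) → T (Pk r n u)
  Pk-mono zero n u h = _
  Pk-mono (suc r) zero u ()
  Pk-mono (suc r) (suc n) u h with T∨→ {u zero ∧ Pk (suc r) n (u ∘ suc)} h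
  ... | inj₁ x = →T∨₁ {u zero ∧ Pk r n (u ∘ suc)} (→T∧ {u zero} (proj₁ (T∧→ {u zero} x)) (Pk-mono r n _ (proj₂ (T∧→ {u zero} x))))
  ... | inj₂ y = →T∨₂ {u zero ∧ Pk r n (u ∘ suc)} (Pk-mono (suc r) n _ y)

  contains-suc : ∀ n x (row cm : Fin n → Bool) (r' : BoolRel n) (α : Fin (suc n) → Bool)
    → containsF (suc n) (bordered x row cm r') α ≡ (α zero ∧ Pk 2 n (λ j → row j ∧ α (suc j))) ∨ containsF n r' (α ∘ suc)
  contains-suc n x row cm r' α = cong₂ _∨_ first (anyᵇ-cong n (λ i → trans (dropZero n _) (anyᵇ-cong n (λ j → false∧∨ (lt i j) _))))
    where
    α' = α ∘ suc
    reorder : ∀ l rj rk a0 aj ak → (l ∧ rj ∧ rk ∧ a0 ∧ aj ∧ ak) ≡ (a0 ∧ (l ∧ (rj ∧ aj) ∧ (rk ∧ ak)))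
    reorder = solve 6 (λ l rj rk a0 aj ak → l :* (rj :* (rk :* (a0 :* (aj :* ak)))) := a0 :* (l :* ((rj :* aj) :* (rk :* ak)))) refl
    first : (anyᵇ n (λ _ → false) ∨ anyᵇ n (λ j → anyᵇ n (λ k → lt j k ∧ row j ∧ row k ∧ α zero ∧ α' j ∧ α' k)))
            ≡ α zero ∧ Pk 2 n (λ j → row j ∧ α' j)
    first = trans (dropZero n _)
              (trans (anyᵇ-cong n (λ j → trans (anyᵇ-cong n (λ k → reorder (lt j k) (row j) (row k) (α zero) (α' j) (α' k))) (anyᵇ-∧ˡ n (α zero) _)))
                     (trans (anyᵇ-∧ˡ n (α zero) _) (cong (α zero ∧_) (Pk2 n _))))

  -- One summand of containsF after the block `row` is merged into r'':
  -- a triple is a hit for the merged relation iff it lies in the block or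
  -- is a hit for r'' (the two relations being disjoint at i).
  splitTriple : ∀ l1 l2 a b ri rj rk x y z → (T ri → a ≡ false) → (T ri → b ≡ false)
     → (l1 ∧ l2 ∧ (a xor (ri ∧ rj)) ∧ (b xor (ri ∧ rk)) ∧ x ∧ y ∧ z)
       ≡ ((l1 ∧ l2 ∧ (ri ∧ x) ∧ (rj ∧ y) ∧ (rk ∧ z)) ∨ (l1 ∧ l2 ∧ a ∧ b ∧ x ∧ y ∧ z))
  splitTriple l1 l2 a b true rj rk x y z ha hb rewrite ha _ | hb _ =
    solve 7 (λ l1 l2 rj rk x y z → l1 :* (l2 :* (rj :* (rk :* (x :* (y :* z)))))
               := l1 :* (l2 :* (x :* ((rj :* y) :* (rk :* z)))) :+ l1 :* (l2 :* (con false :* (con false :* (x :* (y :* z)))))) refl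
      l1 l2 rj rk x y z
  splitTriple l1 l2 a b false rj rk x y z _ _ rewrite xor-identityʳ a | xor-identityʳ b =
    solve 7 (λ l1 l2 a b x y z → l1 :* (l2 :* (a :* (b :* (x :* (y :* z)))))
               := l1 :* (l2 :* (con false :* ((con false :* y) :* (con false :* z)))) :+ l1 :* (l2 :* (a :* (b :* (x :* (y :* z)))))) refl
      l1 l2 a b x y z

  anyᵇ3-∨ : ∀ n (p q : Fin n → Fin n → Fin n → Bool)
    → anyᵇ n (λ i → anyᵇ n (λ j → anyᵇ n (λ k → p i j k ∨ q i j k)))
    ≡ anyᵇ n (λ i → anyᵇ n (λ j → anyᵇ n (λ k → p i j k))) ∨ anyᵇ n (λ i → anyᵇ n (λ j → anyᵇ n (λ k → q i j k)))
  anyᵇ3-∨ n p q = trans (anyᵇ-cong n (λ i → trans (anyᵇ-cong n (λ j → anyᵇ-∨ n (p i j) (q i j))) (anyᵇ-∨ n _ _))) (anyᵇ-∨ n _ _)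

  contains-xor : ∀ n (r'' : BoolRel n) (row : Fin n → Bool) (α : Fin n → Bool) → (∀ i j → T (r'' i j) → T (row i) → ⊥)
    → containsF n (λ i j → r'' i j xor (row i ∧ row j)) α ≡ Pk 3 n (λ i → row i ∧ α i) ∨ containsF n r'' α
  contains-xor n r'' row α dis =
    trans (anyᵇ-cong n (λ i → anyᵇ-cong n (λ j → anyᵇ-cong n (λ k →
       splitTriple (lt i j) (lt j k) (r'' i j) (r'' i k) (row i) (row j) (row k) (α i) (α j) (α k)
          (λ ri → ¬T-false (λ h → dis i j h ri)) (λ ri → ¬T-false (λ h → dis i k h ri))))))
    (trans (anyᵇ3-∨ n _ _) (cong (_∨ containsF n r'' α) (Pk3 n _)))

  contains-resp : ∀ n (m : Mask n) (r : BoolRel n) (α β : Fin n → Bool) → IsPER n m r → (∀ i → T (m i) → α i ≡ β i)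
    → containsF n r α ≡ containsF n r β
  contains-resp n m r α β P e = anyᵇ-cong n (λ i → anyᵇ-cong n (λ j → anyᵇ-cong n (λ k →
    sameOnHits (lt i j) (lt j k) (r i j) (r i k)
      (λ hij hik → e i (dom P i j hij) , e j (dom P j i (sy P i j hij)) , e k (dom P k i (sy P i k hik))))))
    where
    sameOnHits : ∀ l1 l2 a b {x y z x' y' z'} → (T a → T b → (x ≡ x') × (y ≡ y') × (z ≡ z'))
      → (l1 ∧ l2 ∧ a ∧ b ∧ x ∧ y ∧ z) ≡ (l1 ∧ l2 ∧ a ∧ b ∧ x' ∧ y' ∧ z')
    sameOnHits l1 l2 true true f with f _ _
    ... | refl , refl , refl = refl
    sameOnHits l1 l2 true false f = refl
    sameOnHits l1 l2 false b f = refl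


module MatrixSums where

  open import Data.Bool using (Bool; true; false; _∧_; not; _xor_)
  open import Data.Nat using (ℕ; zero; suc; _+_; _*_)
  open import Data.Nat.Properties
  open import Data.Fin using (zero; suc)
  open import Data.Vec using (Vec; []; _∷_; lookup; zipWith; map; replicate)
  open import Data.Vec.Properties using (lookup-zipWith; lookup-map)
  open import Data.Product using (_×_)
  open import Relation.Binary.PropositionalEquality
  open import Defs using (Rel; rel)
  open Booleans
  open FiniteSums
  open PartialEquivalence

  SmVB : ∀ n → Summable (Vec Bool n)
  SmVB n = SmV SmB n

  ΣVB : ∀ n → (Vec Bool n → ℕ) → ℕ
  ΣVB n = ΣV SmB n

  SmR : ∀ n → Summable (Rel n)
  SmR n = SmV (SmVB n) n

  ΣR : ∀ n → (Rel n → ℕ) → ℕ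
  ΣR n = ΣV (SmVB n) n

  build : ∀ {n} → Bool → Vec Bool n → Vec Bool n → Rel n → Rel (suc n)
  build x row cm R' = (x ∷ row) ∷ zipWith _∷_ cm R'

  rel-build : ∀ {n} x (row cm : Vec Bool n) (R' : Rel n) i j → rel (build x row cm R') i j ≡ bordered x (lookup row) (lookup cm) (rel R') i j
  rel-build x row cm R' zero zero = refl
  rel-build x row cm R' zero (suc j) = refl
  rel-build x row cm R' (suc i) zero = cong (λ v → lookup v zero) (lookup-zipWith _∷_ i cm R')
  rel-build x row cm R' (suc i) (suc j) = cong (λ v → lookup v (suc j)) (lookup-zipWith _∷_ i cm R')

  FubVB : ∀ {B : Set} (SB : Summable B) n (h : Vec Bool n → B → ℕ) → ΣVB n (λ x → ∑ SB (h x)) ≡ ∑ SB (λ y → ΣVB n (λ x → h x y))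
  FubVB SB n h = FubV SmB SB (FubB SB) n h

  zipLem : ∀ n k (G : Vec (Vec Bool (suc n)) k → ℕ)
    → ΣV (SmVB (suc n)) k G ≡ ΣVB k (λ cm → ΣV (SmVB n) k (λ R' → G (zipWith _∷_ cm R')))
  zipLem n zero G = refl
  zipLem n (suc k) G =
    cong₂ _+_ (step false) (step true)
    where
    step : ∀ b → ΣVB n (λ r' → ΣV (SmVB (suc n)) k (λ rs → G ((b ∷ r') ∷ rs)))
               ≡ ΣVB k (λ cm → ΣVB n (λ r' → ΣV (SmVB n) k (λ R'' → G ((b ∷ r') ∷ zipWith _∷_ cm R''))))
    step b = trans (∑-cong (SmVB n) (λ r' → zipLem n k (λ rs → G ((b ∷ r') ∷ rs))))
                   (FubVB (SmVB k) n (λ r' cm → ΣV (SmVB n) k (λ R'' → G ((b ∷ r') ∷ zipWith _∷_ cm R''))))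

  ΣR-build : ∀ n (F : Rel (suc n) → ℕ) → ΣR (suc n) F ≡ ΣB (λ x → ΣVB n (λ row → ΣVB n (λ cm → ΣR n (λ R' → F (build x row cm R')))))
  ΣR-build n F = cong₂ _+_ (∑-cong (SmVB n) (λ row → zipLem n n _)) (∑-cong (SmVB n) (λ row → zipLem n n _))

  -- Summation over rows or matrices is invariant under adding (xor) a fixed
  -- row or matrix, since v ↦ v xor w is a bijection.  This lets us trade a
  -- relation r for r xor (block × block).

  ΣB-xor : ∀ (f : Bool → ℕ) a → ΣB f ≡ ΣB (λ b → f (b xor a))
  ΣB-xor f false = refl
  ΣB-xor f true = +-comm (f false) (f true)

  ΣVB-xor : ∀ n (f : Vec Bool n → ℕ) w → ΣVB n f ≡ ΣVB n (λ v → f (zipWith _xor_ v w))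
  ΣVB-xor zero f [] = refl
  ΣVB-xor (suc n) f (a ∷ w) = trans (∑-cong SmB (λ b → ΣVB-xor n (λ v → f (b ∷ v)) w))
                                   (ΣB-xor (λ b → ΣVB n (λ v → f (b ∷ zipWith _xor_ v w))) a)

  xorM : ∀ {n k} → Vec (Vec Bool n) k → Vec (Vec Bool n) k → Vec (Vec Bool n) k
  xorM R S = zipWith (zipWith _xor_) R S

  ΣRows-xor : ∀ n k (f : Vec (Vec Bool n) k → ℕ) S → ΣV (SmVB n) k f ≡ ΣV (SmVB n) k (λ R → f (xorM R S))
  ΣRows-xor n zero f [] = refl
  ΣRows-xor n (suc k) f (w ∷ S') = trans (∑-cong (SmVB n) (λ v → ΣRows-xor n k (λ R → f (v ∷ R)) S'))
                                         (ΣVB-xor n (λ v → ΣV (SmVB n) k (λ R → f (v ∷ xorM R S'))) w)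

  ΣR-xor : ∀ n (f : Rel n → ℕ) S → ΣR n f ≡ ΣR n (λ R → f (xorM R S))
  ΣR-xor n = ΣRows-xor n n

  rel-xor : ∀ {n} (R S : Rel n) i j → rel (xorM R S) i j ≡ rel R i j xor rel S i j
  rel-xor R S i j = trans (cong (λ v → lookup v j) (lookup-zipWith (zipWith _xor_) i R S)) (lookup-zipWith _xor_ j (lookup R i) (lookup S i))

  outer : ∀ {n} → Vec Bool n → Rel n
  outer v = map (λ a → map (a ∧_) v) v

  rel-outer : ∀ {n} (v : Vec Bool n) i j → rel (outer v) i j ≡ lookup v i ∧ lookup v j
  rel-outer v i j = trans (cong (λ w → lookup w j) (lookup-map i (λ a → map (a ∧_) v) v)) (lookup-map j (lookup v i ∧_) v)

  ΣB-sel : ∀ (f : Bool → ℕ) → ΣB (λ x → ⟦ x ⟧ * f x) ≡ f true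
  ΣB-sel f = +-identityʳ (f true)

  ΣB-selnot : ∀ (f : Bool → ℕ) → ΣB (λ x → ⟦ not x ⟧ * f x) ≡ f false
  ΣB-selnot f = trans (+-identityʳ (f false + 0)) (+-identityʳ (f false))

  ΣVB-zero : ∀ n (f : Vec Bool n → ℕ) → ΣVB n (λ v → ⟦ allᵇ n (λ j → not (lookup v j)) ⟧ * f v) ≡ f (replicate n false)
  ΣVB-zero zero f = +-identityʳ (f [])
  ΣVB-zero (suc n) f = trans (cong₂ _+_ (ΣVB-zero n (λ v → f (false ∷ v))) (∑-0 (SmVB n))) (+-identityʳ _)

  ΣVB-eq : ∀ n (w : Vec Bool n) → ΣVB n (λ v → ⟦ allᵇ n (λ j → sameᵇ (lookup w j) (lookup v j)) ⟧) ≡ 1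
  ΣVB-eq zero [] = refl
  ΣVB-eq (suc n) (true ∷ w) = trans (cong (_+ ΣVB n (λ v → ⟦ allᵇ n (λ j → sameᵇ (lookup w j) (lookup v j)) ⟧)) (∑-0 (SmVB n))) (ΣVB-eq n w)
  ΣVB-eq (suc n) (false ∷ w) = trans (cong (ΣVB n (λ v → ⟦ allᵇ n (λ j → sameᵇ (lookup w j) (lookup v j)) ⟧) +_) (∑-0 (SmVB n))) (trans (+-identityʳ _) (ΣVB-eq n w))


module Colourings (c' : ℕ) (a : Fin (suc c')) where
  open import Data.Nat using (ℕ; zero; suc; _+_; _*_; _^_)
  open import Data.Fin using (Fin; zero; suc)

  open import Data.Bool using (Bool; true; false; _∧_; _∨_; not; T)
  open import Data.Nat.Properties hiding (_≟_)
  open import Data.Nat.Tactic.RingSolver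
  open import Data.Fin.Properties using (_≟_)
  open import Data.Vec using (Vec; _∷_; lookup)
  open import Data.Empty using (⊥-elim)
  open import Data.Unit using (tt)
  open import Relation.Nullary.Decidable using (⌊_⌋)
  import Relation.Nullary
  open import Relation.Binary.PropositionalEquality
  open Booleans
  open FiniteSums
  open PartialEquivalence
  open Containment

  c : ℕ
  c = suc c'

  SmC : ∀ n → Summable (Vec (Fin c) n)
  SmC n = SmV (SmF c) n

  ΣC : ∀ n → (Vec (Fin c) n → ℕ) → ℕ
  ΣC n = ΣV (SmF c) n

  αc : ∀ {n} → Vec (Fin c) n → Fin n → Bool
  αc col i = ⌊ lookup col i ≟ a ⌋

  ΣF-const : ∀ k x → ΣF k (λ _ → x) ≡ k * x
  ΣF-const zero x = refl
  ΣF-const (suc k) x = cong (x +_) (ΣF-const k x)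

  ≟-suc : ∀ {m} (x y : Fin m) → ⌊ suc x ≟ suc y ⌋ ≡ ⌊ x ≟ y ⌋
  ≟-suc x y with x ≟ y
  ... | Relation.Nullary.yes _ = refl
  ... | Relation.Nullary.no _ = refl

  Σk-gen : ∀ d (b : Fin (suc d)) (f : Bool → ℕ) → ΣF (suc d) (λ k → f ⌊ k ≟ b ⌋) ≡ f true + d * f false
  Σk-gen d zero f = cong (f true +_) (ΣF-const d (f false))
  Σk-gen (suc d) (suc b) f = trans (cong (f false +_) (trans (∑-cong (SmF (suc d)) (λ k → cong f (≟-suc k b))) (Σk-gen d b f))) (lem (f false) (f true) (d * f false))
    where lem : ∀ x y z → x + (y + z) ≡ y + (x + z)
          lem = solve-∀

  Σk : ∀ (f : Bool → ℕ) → ΣF c (λ k → f ⌊ k ≟ a ⌋) ≡ f true + c' * f false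
  Σk f = Σk-gen c' a f

  size : ∀ n → (Fin n → Bool) → ℕ
  size zero m = 0
  size (suc n) m = ⟦ m zero ⟧ + size n (λ i → m (suc i))


  -- atMost q r: the number of colourings of q elements in which at most r
  -- elements get colour a (by Pascal's rule on the colour of the first).
  atMost : ℕ → ℕ → ℕ
  atMost zero r = 1
  atMost (suc q) zero = c' * atMost q zero
  atMost (suc q) (suc r) = atMost q r + c' * atMost q (suc r)

  manyA : ℕ → ∀ n → (Fin n → Bool) → Vec (Fin c) n → Bool
  manyA r n row col = Pk r n (λ i → row i ∧ αc col i)

  rowColourings : ℕ → ∀ n → (Fin n → Bool) → ℕ
  rowColourings r n row = ΣC n (λ col → ⟦ not (manyA (suc r) n row col) ⟧)

  notor-mono : ∀ p q → (T q → T p) → ⟦ not (p ∨ q) ⟧ ≡ ⟦ not p ⟧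
  notor-mono true q f = refl
  notor-mono false true f = ⊥-elim (f tt)
  notor-mono false false f = refl

  -- Colouring the first element of a row: colour a uses up one of the
  -- allowed occurrences, the other c' colours use none.
  firstColour : ∀ r n (row : Fin n → Bool) →
      ΣF c (λ k → ΣC n (λ col → ⟦ not ((⌊ k ≟ a ⌋ ∧ manyA r n row col) ∨ manyA (suc r) n row col) ⟧))
      ≡ ΣC n (λ col → ⟦ not (manyA r n row col ∨ manyA (suc r) n row col) ⟧) + c' * rowColourings r n row
  firstColour r n row =
    trans (FubF (SmC n) c (λ k col → ⟦ not ((⌊ k ≟ a ⌋ ∧ manyA r n row col) ∨ manyA (suc r) n row col) ⟧))
          (trans (∑-cong (SmC n) (λ col → Σk (λ t → ⟦ not ((t ∧ manyA r n row col) ∨ manyA (suc r) n row col) ⟧)))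
                 (trans (∑-+ (SmC n) _ _) (cong (ΣC n (λ col → ⟦ not (manyA r n row col ∨ manyA (suc r) n row col) ⟧) +_) (∑-*ˡ (SmC n) c' _))))

  -- The positions outside `row` are free: c^|row| · rowColourings = c^n · atMost |row| r.
  rowColourings-count : ∀ r n (row : Fin n → Bool) → c ^ size n row * rowColourings r n row ≡ c ^ n * atMost (size n row) r
  rowColourings-count r zero row = refl
  rowColourings-count r (suc n) row with row zero
  ... | false = begin
      c ^ s * ΣF c (λ k → rowColourings r n row')   ≡⟨ cong (c ^ s *_) (ΣF-const c _) ⟩
      c ^ s * (c * rowColourings r n row')          ≡⟨ swap (c ^ s) c (rowColourings r n row') ⟩
      c * (c ^ s * rowColourings r n row')          ≡⟨ cong (c *_) (rowColourings-count r n row') ⟩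
      c * (c ^ n * atMost s r)                      ≡⟨ sym (*-assoc c (c ^ n) _) ⟩
      c ^ suc n * atMost s r ∎
    where
    open ≡-Reasoning
    row' = λ i → row (suc i)
    s = size n row'
    swap : ∀ x y z → x * (y * z) ≡ y * (x * z)
    swap = solve-∀
  ... | true = byBound r
    where
    open ≡-Reasoning
    row' = λ i → row (suc i)
    s = size n row'
    byBound : ∀ r → c ^ (1 + s) * ΣF c (λ k → ΣC n (λ col → ⟦ not ((⌊ k ≟ a ⌋ ∧ manyA r n row' col) ∨ manyA (suc r) n row' col) ⟧))
                  ≡ c ^ suc n * atMost (1 + s) r
    byBound zero = begin
        c ^ (1 + s) * _                                            ≡⟨ cong (c ^ (1 + s) *_) (firstColour zero n row') ⟩
        c ^ (1 + s) * (ΣC n (λ _ → 0) + c' * rowColourings 0 n row') ≡⟨ cong (λ z → c ^ (1 + s) * (z + c' * rowColourings 0 n row')) (∑-0 (SmC n)) ⟩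
        (c * c ^ s) * (c' * rowColourings 0 n row')                 ≡⟨ interchange c (c ^ s) c' (rowColourings 0 n row') ⟩
        (c * c') * (c ^ s * rowColourings 0 n row')                 ≡⟨ cong ((c * c') *_) (rowColourings-count 0 n row') ⟩
        (c * c') * (c ^ n * atMost s 0)                             ≡⟨ interchange c c' (c ^ n) (atMost s 0) ⟩
        (c * c ^ n) * (c' * atMost s 0) ∎
      where
      interchange : ∀ x y z w → (x * y) * (z * w) ≡ (x * z) * (y * w)
      interchange = solve-∀
    byBound (suc r) = begin
        c ^ (1 + s) * _ ≡⟨ cong (c ^ (1 + s) *_) (firstColour (suc r) n row') ⟩
        c ^ (1 + s) * (ΣC n (λ col → ⟦ not (manyA (suc r) n row' col ∨ manyA (suc (suc r)) n row' col) ⟧) + c' * rowColourings (suc r) n row')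
          ≡⟨ cong (λ z → c ^ (1 + s) * (z + c' * rowColourings (suc r) n row')) (∑-cong (SmC n) (λ col → notor-mono _ _ (Pk-mono (suc r) n _))) ⟩
        (c * c ^ s) * (rowColourings r n row' + c' * rowColourings (suc r) n row')
          ≡⟨ expand c (c ^ s) (rowColourings r n row') c' (rowColourings (suc r) n row') ⟩
        c * (c ^ s * rowColourings r n row') + c' * (c * (c ^ s * rowColourings (suc r) n row'))
          ≡⟨ cong₂ (λ u v → c * u + c' * (c * v)) (rowColourings-count r n row') (rowColourings-count (suc r) n row') ⟩
        c * (c ^ n * atMost s r) + c' * (c * (c ^ n * atMost s (suc r)))
          ≡⟨ sym (expand c (c ^ n) (atMost s r) c' (atMost s (suc r))) ⟩
        (c * c ^ n) * (atMost s r + c' * atMost s (suc r)) ∎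
      where
      expand : ∀ x y z w v → (x * y) * (z + w * v) ≡ x * (y * z) + w * (x * (y * v))
      expand = solve-∀

  respC : ∀ n → (Fin n → Bool) → (Vec (Fin c) n → ℕ) → Set
  respC n t F = ∀ v w → (∀ i → T (t i) → lookup v i ≡ lookup w i) → F v ≡ F w

  factorise : ∀ n (s : Fin n → Bool) (F G : Vec (Fin c) n → ℕ) → respC n (λ i → not (s i)) F → respC n s G
       → c ^ n * ΣC n (λ v → F v * G v) ≡ ΣC n F * ΣC n G
  factorise zero s F G rF rG = +-identityʳ _
  factorise (suc n) s F G rF rG with s zero in eq
  ... | true = begin
      c ^ suc n * ΣF c (λ k → ΣC n (λ v → F (k ∷ v) * G (k ∷ v)))
        ≡⟨ cong (c ^ suc n *_) (∑-cong (SmF c) (λ k → ∑-cong (SmC n) (λ v → cong (_* G (k ∷ v)) (F0 k v)))) ⟩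
      c ^ suc n * ΣF c (λ k → ΣC n (λ v → F (zero ∷ v) * G (k ∷ v)))
        ≡⟨ cong (c ^ suc n *_) (trans (FubF (SmC n) c (λ k v → F (zero ∷ v) * G (k ∷ v))) (∑-cong (SmC n) (λ v → ∑-*ˡ (SmF c) (F (zero ∷ v)) (λ k → G (k ∷ v))))) ⟩
      (c * c ^ n) * ΣC n (λ v → F (zero ∷ v) * G' v)
        ≡⟨ *-assoc c (c ^ n) _ ⟩
      c * (c ^ n * ΣC n (λ v → F (zero ∷ v) * G' v))
        ≡⟨ cong (c *_) (factorise n s' (λ v → F (zero ∷ v)) G' rF' rG') ⟩
      c * (ΣC n (λ v → F (zero ∷ v)) * ΣC n G')
        ≡⟨ sym (*-assoc c (ΣC n (λ v → F (zero ∷ v))) (ΣC n G')) ⟩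
      (c * ΣC n (λ v → F (zero ∷ v))) * ΣC n G'
        ≡⟨ cong₂ _*_ (sym (trans (∑-cong (SmF c) (λ k → ∑-cong (SmC n) (λ v → F0 k v))) (ΣF-const c _))) (sym (FubF (SmC n) c (λ k v → G (k ∷ v)))) ⟩
      ΣF c (λ k → ΣC n (λ v → F (k ∷ v))) * ΣF c (λ k → ΣC n (λ v → G (k ∷ v))) ∎
    where
    open ≡-Reasoning
    s' = λ i → s (suc i)
    G' : Vec (Fin c) n → ℕ
    G' v = ΣF c (λ k → G (k ∷ v))
    F0 : ∀ k v → F (k ∷ v) ≡ F (zero ∷ v)
    F0 k v = rF (k ∷ v) (zero ∷ v) (λ { zero h → ⊥-elim (Tnot→ h (subst T (sym eq) tt)) ; (suc i) h → refl })
    rF' : respC n (λ i → not (s' i)) (λ v → F (zero ∷ v))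
    rF' v w e = rF (zero ∷ v) (zero ∷ w) (λ { zero h → refl ; (suc i) h → e i h })
    rG' : respC n s' G'
    rG' v w e = ∑-cong (SmF c) (λ k → rG (k ∷ v) (k ∷ w) (λ { zero h → refl ; (suc i) h → e i h }))
  ... | false = begin
      c ^ suc n * ΣF c (λ k → ΣC n (λ v → F (k ∷ v) * G (k ∷ v)))
        ≡⟨ cong (c ^ suc n *_) (∑-cong (SmF c) (λ k → ∑-cong (SmC n) (λ v → cong (F (k ∷ v) *_) (G0 k v)))) ⟩
      c ^ suc n * ΣF c (λ k → ΣC n (λ v → F (k ∷ v) * G (zero ∷ v)))
        ≡⟨ cong (c ^ suc n *_) (trans (FubF (SmC n) c (λ k v → F (k ∷ v) * G (zero ∷ v))) (∑-cong (SmC n) (λ v → ∑-*ʳ (SmF c) (G (zero ∷ v)) (λ k → F (k ∷ v))))) ⟩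
      (c * c ^ n) * ΣC n (λ v → F' v * G (zero ∷ v))
        ≡⟨ *-assoc c (c ^ n) _ ⟩
      c * (c ^ n * ΣC n (λ v → F' v * G (zero ∷ v)))
        ≡⟨ cong (c *_) (factorise n s' F' (λ v → G (zero ∷ v)) rF' rG') ⟩
      c * (ΣC n F' * ΣC n (λ v → G (zero ∷ v)))
        ≡⟨ lsw c (ΣC n F') (ΣC n (λ v → G (zero ∷ v))) ⟩
      ΣC n F' * (c * ΣC n (λ v → G (zero ∷ v)))
        ≡⟨ cong₂ _*_ (sym (FubF (SmC n) c (λ k v → F (k ∷ v)))) (sym (trans (∑-cong (SmF c) (λ k → ∑-cong (SmC n) (λ v → G0 k v))) (ΣF-const c _))) ⟩
      ΣF c (λ k → ΣC n (λ v → F (k ∷ v))) * ΣF c (λ k → ΣC n (λ v → G (k ∷ v))) ∎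
    where
    open ≡-Reasoning
    lsw : ∀ x y z → x * (y * z) ≡ y * (x * z)
    lsw = solve-∀
    s' = λ i → s (suc i)
    F' : Vec (Fin c) n → ℕ
    F' v = ΣF c (λ k → F (k ∷ v))
    G0 : ∀ k v → G (k ∷ v) ≡ G (zero ∷ v)
    G0 k v = rG (k ∷ v) (zero ∷ v) (λ { zero h → ⊥-elim (subst T eq h) ; (suc i) h → refl })
    rG' : respC n s' (λ v → G (zero ∷ v))
    rG' v w e = rG (zero ∷ v) (zero ∷ w) (λ { zero h → refl ; (suc i) h → e i h })
    rF' : respC n (λ i → not (s' i)) F'
    rF' v w e = ∑-cong (SmF c) (λ k → rF (k ∷ v) (k ∷ w) (λ { zero h → refl ; (suc i) h → e i h }))


module Convolution where

  open import Data.Nat using (ℕ; zero; suc; _+_; _*_)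
  open import Data.Nat.Properties
  open import Relation.Binary.PropositionalEquality

  -- binConv s g = Σ_{k+l=s} C(s,k) g k l, defined by Pascal's rule
  -- (the first element of an s-set goes either to the k-part or the l-part).
  binConv : ℕ → (ℕ → ℕ → ℕ) → ℕ
  binConv zero g = g 0 0
  binConv (suc s) g = binConv s (λ k l → g (suc k) l) + binConv s (λ k l → g k (suc l))

  binConv-cong : ∀ s {g h : ℕ → ℕ → ℕ} → (∀ k l → k + l ≡ s → g k l ≡ h k l) → binConv s g ≡ binConv s h
  binConv-cong zero e = e 0 0 refl
  binConv-cong (suc s) e = cong₂ _+_ (binConv-cong s (λ k l p → e (suc k) l (cong suc p)))
                                  (binConv-cong s (λ k l p → e k (suc l) (trans (+-suc k l) (cong suc p))))

  binConv-scal : ∀ s x g → binConv s (λ k l → x * g k l) ≡ x * binConv s g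
  binConv-scal zero x g = refl
  binConv-scal (suc s) x g = trans (cong₂ _+_ (binConv-scal s x _) (binConv-scal s x _)) (sym (*-distribˡ-+ x _ _))



module BlockRecursion (c' : ℕ) (a : Fin (suc c')) where
  open import Data.Nat using (ℕ; zero; suc; _+_; _*_; _^_; _≤_; s≤s)
  open import Data.Fin using (Fin; zero; suc)

  open import Data.Bool using (Bool; true; false; _∧_; _∨_; not; T; _xor_)
  open import Data.Nat.Properties hiding (_≟_)
  open import Data.Nat.Tactic.RingSolver
  open import Data.Vec using (Vec; []; _∷_; lookup; tail)
  open import Data.Product using (proj₂)
  open import Data.Sum using (inj₁; inj₂)
  import Relation.Nullary.Decidable
  import Data.Fin.Properties
  open import Data.Empty using (⊥-elim)
  open import Data.Unit using (tt)
  open import Relation.Binary.PropositionalEquality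
  open import Defs using (Rel; rel; _⇒ᵇ_)
  open import Function using (_∘_)
  open Booleans
  open FiniteSums
  open PartialEquivalence
  open Containment
  open MatrixSums
  open Colourings c' a
  open Convolution
  open import Data.Bool.Properties using (∧-zeroʳ; ∨-zeroʳ; ∨-identityʳ; xor-assoc; xor-same; xor-identityʳ)
  import Data.Bool.Solver
  module BS = Data.Bool.Solver.∨-∧-Solver

  -- avoiders s: the number of coloured set partitions of an s-set avoiding
  -- the pattern, given by the block recursion
  --   avoiders (s+1) = Σ_{k+l=s} C(s,k) · atMost (k+1) 2 · avoiders l
  -- (choose the k other elements of the block of the first element; that
  -- block may contain at most two elements of colour a).  avoidersF adds
  -- fuel to make the recursion structural.

  avoidersF : ℕ → ℕ → ℕ
  avoidersF f zero = 1
  avoidersF zero (suc s) = 0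
  avoidersF (suc f) (suc s) = binConv s (λ k l → atMost (suc k) 2 * avoidersF f l)

  avoiders : ℕ → ℕ
  avoiders s = avoidersF s s

  avoidersF-stable : ∀ f f' s → s ≤ f → s ≤ f' → avoidersF f s ≡ avoidersF f' s
  avoidersF-stable f f' zero _ _ = refl
  avoidersF-stable (suc f) (suc f') (suc s) (s≤s p) (s≤s q) =
    binConv-cong s (λ k l e → cong (atMost (suc k) 2 *_) (avoidersF-stable f f' l (≤-trans (lle k l s e) p) (≤-trans (lle k l s e) q)))
    where
    lle : ∀ k l s → k + l ≡ s → l ≤ s
    lle k l s e = subst (l ≤_) e (m≤n+m l k)

  avoiders-rec : ∀ s → avoiders (suc s) ≡ binConv s (λ k l → atMost (suc k) 2 * avoiders l)
  avoiders-rec s = binConv-cong s (λ k l e → cong (atMost (suc k) 2 *_) (avoidersF-stable s l l (subst (l ≤_) e (m≤n+m l k)) ≤-refl))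

  ⊆ᵇ : ∀ n → Vec Bool n → (Fin n → Bool) → Bool
  ⊆ᵇ n row m = allᵇ n (λ j → lookup row j ⇒ᵇ m j)

  maskMinus : ∀ n → (Fin n → Bool) → Vec Bool n → Fin n → Bool
  maskMinus n m row i = m i ∧ not (lookup row i)

  subsetSum : ∀ n (m : Fin n → Bool) (g : ℕ → ℕ → ℕ)
    → ΣVB n (λ row → ⟦ ⊆ᵇ n row m ⟧ * g (size n (lookup row)) (size n (maskMinus n m row))) ≡ binConv (size n m) g
  subsetSum zero m g = +-identityʳ (g 0 0)
  subsetSum (suc n) m g with m zero
  ... | true = trans (cong₂ _+_ (subsetSum n (λ i → m (suc i)) (λ k l → g k (suc l))) (subsetSum n (λ i → m (suc i)) (λ k l → g (suc k) l)))
                     (+-comm (binConv (size n (λ i → m (suc i))) (λ k l → g k (suc l))) (binConv (size n (λ i → m (suc i))) (λ k l → g (suc k) l)))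
  ... | false = trans (cong₂ _+_ (subsetSum n (λ i → m (suc i)) g) (∑-0 (SmVB n))) (+-identityʳ _)

  -- The rest of this module shows
  --   c^|m| · countAvoiding n m = c^n · avoiders |m|
  -- by splitting off element 0 (stepFalse / stepTrue); the factor c^(n-|m|)
  -- accounts for the free colours of the elements outside the domain.

  countAvoiding : ∀ n → (Fin n → Bool) → ℕ
  countAvoiding n m = ΣR n (λ R → ΣC n (λ col → ⟦ isPERᵇ n m (rel R) ∧ not (containsF n (rel R) (αc col)) ⟧))

  containsF-cong : ∀ n {r r' : BoolRel n} α → (∀ i j → r i j ≡ r' i j) → containsF n r α ≡ containsF n r' α
  containsF-cong n α e = anyᵇ-cong n (λ i → anyᵇ-cong n (λ j → anyᵇ-cong n (λ k →
    cong₂ (λ u v → lt i j ∧ lt j k ∧ u ∧ v ∧ α i ∧ α j ∧ α k) (e i j) (e i k))))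


  Pk-zero : ∀ r n (u : Fin n → Bool) → (∀ i → u i ≡ false) → Pk (suc r) n u ≡ false
  Pk-zero r zero u e = refl
  Pk-zero r (suc n) u e rewrite e zero = Pk-zero r n _ (λ i → e (suc i))

  boolF : ∀ nx zr zc pe a p C → (T zr → p ≡ false)
    → ⟦ (nx ∧ zr ∧ zc ∧ pe) ∧ not ((a ∧ p) ∨ C) ⟧ ≡ ⟦ nx ⟧ * (⟦ zr ⟧ * (⟦ zc ⟧ * ⟦ pe ∧ not C ⟧))
  boolF nx zr zc pe a p C h = trans (cong ⟦_⟧ (split zr h)) (⟦∧⟧₄ nx zr zc (pe ∧ not C))
    where
    split : ∀ zr → (T zr → p ≡ false) → ((nx ∧ zr ∧ zc ∧ pe) ∧ not ((a ∧ p) ∨ C)) ≡ (nx ∧ zr ∧ zc ∧ (pe ∧ not C))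
    split true h rewrite h _ | ∧-zeroʳ a =
      BS.solve 4 (λ nx zc pe nC → (nx BS.:* (zc BS.:* pe)) BS.:* nC BS.:= nx BS.:* (zc BS.:* (pe BS.:* nC))) refl nx zc pe (not C)
    split false h rewrite ∧-zeroʳ nx = refl

  boolT : ∀ x e sb pe a p2 p3 cc C → (T pe → C ≡ (p3 ∨ cc))
    → ⟦ (x ∧ e ∧ sb ∧ pe) ∧ not ((a ∧ p2) ∨ C) ⟧ ≡ (⟦ x ⟧ * (⟦ e ⟧ * ⟦ sb ⟧)) * (⟦ pe ∧ not cc ⟧ * ⟦ not ((a ∧ p2) ∨ p3) ⟧)
  boolT x e sb pe a p2 p3 cc C h =
    trans (cong ⟦_⟧ (split pe h))
          (trans (⟦∧⟧ (x ∧ e ∧ sb) _) (cong₂ _*_ (⟦∧⟧₃ x e sb) (⟦∧⟧ (pe ∧ not cc) _)))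
    where
    split : ∀ pe → (T pe → C ≡ (p3 ∨ cc))
          → ((x ∧ e ∧ sb ∧ pe) ∧ not ((a ∧ p2) ∨ C)) ≡ ((x ∧ e ∧ sb) ∧ ((pe ∧ not cc) ∧ not ((a ∧ p2) ∨ p3)))
    split false h = BS.solve 4 (λ x e sb Y → (x BS.:* (e BS.:* (sb BS.:* BS.con false))) BS.:* Y
                                   BS.:= (x BS.:* (e BS.:* sb)) BS.:* BS.con false) refl x e sb _
    split true h rewrite h _ = byCc cc
      where
      byCc : ∀ cc → ((x ∧ e ∧ sb ∧ true) ∧ not ((a ∧ p2) ∨ (p3 ∨ cc))) ≡ ((x ∧ e ∧ sb) ∧ ((true ∧ not cc) ∧ not ((a ∧ p2) ∨ p3)))
      byCc true rewrite ∨-zeroʳ p3 | ∨-zeroʳ (a ∧ p2) | ∧-zeroʳ (x ∧ e ∧ sb ∧ true) | ∧-zeroʳ (x ∧ e ∧ sb) = refl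
      byCc false rewrite ∨-identityʳ p3 =
        BS.solve 4 (λ x e sb N → (x BS.:* (e BS.:* (sb BS.:* BS.con true))) BS.:* N BS.:= (x BS.:* (e BS.:* sb)) BS.:* N) refl x e sb _


  pullConstant : ∀ n (K : ℕ) (h : Rel n → Fin c → Vec (Fin c) n → ℕ)
    → ΣR n (λ R' → ΣF c (λ k → ΣC n (λ col' → K * h R' k col'))) ≡ K * ΣR n (λ R' → ΣF c (λ k → ΣC n (λ col' → h R' k col')))
  pullConstant n K h = trans (∑-cong (SmR n) (λ R' → trans (∑-cong (SmF c) (λ k → ∑-*ˡ (SmC n) K (h R' k))) (∑-*ˡ (SmF c) K (λ k → ΣC n (h R' k))))) (∑-*ˡ (SmR n) K (λ R' → ΣF c (λ k → ΣC n (h R' k))))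

  zeroRow : ∀ n → Vec Bool n → Bool
  zeroRow n v = allᵇ n (λ j → not (lookup v j))

  sameRow : ∀ n → Vec Bool n → Vec Bool n → Bool
  sameRow n row cm = allᵇ n (λ j → sameᵇ (lookup row j) (lookup cm j))

  summand-outside : ∀ n (m : Fin (suc n) → Bool) → m zero ≡ false → ∀ x row cm R' k col' →
      ⟦ isPERᵇ (suc n) m (rel (build x row cm R')) ∧ not (containsF (suc n) (rel (build x row cm R')) (αc (k ∷ col'))) ⟧
      ≡ (⟦ not x ⟧ * (⟦ zeroRow n row ⟧ * ⟦ zeroRow n cm ⟧)) * ⟦ isPERᵇ n (m ∘ suc) (rel R') ∧ not (containsF n (rel R') (αc col')) ⟧
  summand-outside n m eq x row cm R' k col' =
    trans (cong₂ (λ p q → ⟦ p ∧ not q ⟧)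
                 (trans (isPERᵇ-cong (suc n) em (rel-build x row cm R')) (isPERᵇ-outside n m' x (lookup row) (lookup cm) (rel R')))
                 (trans (containsF-cong (suc n) (αc (k ∷ col')) (rel-build x row cm R')) (contains-suc n x (lookup row) (lookup cm) (rel R') (αc (k ∷ col')))))
    (trans (boolF (not x) (zeroRow n row) (zeroRow n cm) (isPERᵇ n m' (rel R')) (αc (k ∷ col') zero) (Pk 2 n (λ j → lookup row j ∧ αc col' j)) (containsF n (rel R') (αc col'))
                  (λ h → Pk-zero 1 n _ (λ i → cong (_∧ αc col' i) (¬T-false (Tnot→ (allᵇ→ n h i))))))
           (as4 (⟦ not x ⟧) (⟦ zeroRow n row ⟧) (⟦ zeroRow n cm ⟧) _))
    where
    m' = m ∘ suc
    em : ∀ i → m i ≡ maskCons false m' i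
    em zero = eq
    em (suc i) = refl
    as4 : ∀ a b c d → a * (b * (c * d)) ≡ (a * (b * c)) * d
    as4 = solve-∀

  -- Element 0 outside the domain: its colour is free, everything else is a
  -- configuration on 1..n.
  stepFalse : ∀ n (m : Fin (suc n) → Bool) → m zero ≡ false → countAvoiding (suc n) m ≡ c * countAvoiding n (λ i → m (suc i))
  stepFalse n m eq =
    begin
      countAvoiding (suc n) m
        ≡⟨ ΣR-build n (λ R → ΣC (suc n) (λ col → ⟦ isPERᵇ (suc n) m (rel R) ∧ not (containsF (suc n) (rel R) (αc col)) ⟧)) ⟩
      ΣB (λ x → ΣVB n (λ row → ΣVB n (λ cm → ΣR n (λ R' → ΣF c (λ k → ΣC n (λ col' → body x row cm R' k col'))))))
        ≡⟨ ∑-cong SmB (λ x → ∑-cong (SmVB n) (λ row → ∑-cong (SmVB n) (λ cm → ∑-cong (SmR n) (λ R' → ∑-cong (SmF c) (λ k → ∑-cong (SmC n) (λ col' → summand-outside n m eq x row cm R' k col')))))) ⟩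
      ΣB (λ x → ΣVB n (λ row → ΣVB n (λ cm → ΣR n (λ R' → ΣF c (λ k → ΣC n (λ col' → (⟦ not x ⟧ * (⟦ zeroRow n row ⟧ * ⟦ zeroRow n cm ⟧)) * H R' col'))))))
        ≡⟨ ∑-cong SmB (λ x → ∑-cong (SmVB n) (λ row → ∑-cong (SmVB n) (λ cm → pullConstant n (⟦ not x ⟧ * (⟦ zeroRow n row ⟧ * ⟦ zeroRow n cm ⟧)) (λ R' k col' → H R' col')))) ⟩
      ΣB (λ x → ΣVB n (λ row → ΣVB n (λ cm → (⟦ not x ⟧ * (⟦ zeroRow n row ⟧ * ⟦ zeroRow n cm ⟧)) * Q)))
        ≡⟨ ∑-cong SmB (λ x → ∑-cong (SmVB n) (λ row → ∑-cong (SmVB n) (λ cm → rearr (⟦ not x ⟧) (⟦ zeroRow n row ⟧) (⟦ zeroRow n cm ⟧) Q))) ⟩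
      ΣB (λ x → ΣVB n (λ row → ΣVB n (λ cm → ⟦ zeroRow n cm ⟧ * (⟦ zeroRow n row ⟧ * (⟦ not x ⟧ * Q)))))
        ≡⟨ ∑-cong SmB (λ x → ∑-cong (SmVB n) (λ row → ΣVB-zero n (λ _ → ⟦ zeroRow n row ⟧ * (⟦ not x ⟧ * Q)))) ⟩
      ΣB (λ x → ΣVB n (λ row → ⟦ zeroRow n row ⟧ * (⟦ not x ⟧ * Q)))
        ≡⟨ ∑-cong SmB (λ x → ΣVB-zero n (λ _ → ⟦ not x ⟧ * Q)) ⟩
      ΣB (λ x → ⟦ not x ⟧ * Q)
        ≡⟨ ΣB-selnot (λ _ → Q) ⟩
      Q
        ≡⟨ ∑-cong (SmR n) (λ R' → ΣF-const c (ΣC n (H R'))) ⟩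
      ΣR n (λ R' → c * ΣC n (H R'))
        ≡⟨ ∑-*ˡ (SmR n) c _ ⟩
      c * countAvoiding n m' ∎
    where
    open ≡-Reasoning
    m' = λ i → m (suc i)
    body : Bool → Vec Bool n → Vec Bool n → Rel n → Fin c → Vec (Fin c) n → ℕ
    body x row cm R' k col' = ⟦ isPERᵇ (suc n) m (rel (build x row cm R')) ∧ not (containsF (suc n) (rel (build x row cm R')) (αc (k ∷ col'))) ⟧
    H : Rel n → Vec (Fin c) n → ℕ
    H R' col' = ⟦ isPERᵇ n m' (rel R') ∧ not (containsF n (rel R') (αc col')) ⟧
    Q = ΣR n (λ R' → ΣF c (λ k → ΣC n (λ col' → H R' col')))
    rearr : ∀ x y z q → (x * (y * z)) * q ≡ z * (y * (x * q))
    rearr = solve-∀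

  xor-inv : ∀ p q → ((p xor q) xor q) ≡ p
  xor-inv p q = trans (xor-assoc p q q) (trans (cong (p xor_) (xor-same q)) (xor-identityʳ p))

  ∧-resp : ∀ b x y → (T b → x ≡ y) → (b ∧ x) ≡ (b ∧ y)
  ∧-resp true x y f = f tt
  ∧-resp false x y f = refl

  blockColourings : ∀ n → Vec Bool n → ℕ
  blockColourings n row = rowColourings 2 (suc n) (maskCons true (lookup row))

  -- For a fixed block {0} ∪ row of element 0, the remaining configurations
  -- (a PER on m' ∖ row, after undoing the xor with the block) and the
  -- colourings of the block are independent, so the sum factorises.
  blockOfZero-sum : ∀ n (m' : Fin n → Bool) (row : Vec Bool n)
    → c ^ suc n * ΣR n (λ R' → ΣF c (λ k → ΣC n (λ col' →
          ⟦ isPERᵇ n (maskMinus n m' row) (λ i j → rel R' i j xor (lookup row i ∧ lookup row j)) ∧ not (containsF n (λ i j → rel R' i j xor (lookup row i ∧ lookup row j)) (αc col')) ⟧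
          * ⟦ not (Pk 3 (suc n) (λ i → maskCons true (lookup row) i ∧ αc (k ∷ col') i)) ⟧)))
      ≡ countAvoiding n (maskMinus n m' row) * (c * blockColourings n row)
  blockOfZero-sum n m' row =
    begin
      c ^ suc n * ΣR n (λ R' → Φ (λ i j → rel R' i j xor (lookup row i ∧ lookup row j)))
        ≡⟨ cong (c ^ suc n *_) (ΣR-xor n (λ R' → Φ (λ i j → rel R' i j xor (lookup row i ∧ lookup row j))) (outer row)) ⟩
      c ^ suc n * ΣR n (λ R → Φ (λ i j → rel (xorM R (outer row)) i j xor (lookup row i ∧ lookup row j)))
        ≡⟨ cong (c ^ suc n *_) (∑-cong (SmR n) (λ R → Φ-cong R)) ⟩
      c ^ suc n * ΣR n (λ R → Φ (rel R))
        ≡⟨ sym (∑-*ˡ (SmR n) (c ^ suc n) _) ⟩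
      ΣR n (λ R → c ^ suc n * Φ (rel R))
        ≡⟨ ∑-cong (SmR n) (λ R → factorise (suc n) s (F̂ R) G' (rF R) rG) ⟩
      ΣR n (λ R → ΣC (suc n) (F̂ R) * blockColourings n row)
        ≡⟨ ∑-cong (SmR n) (λ R → trans (cong (_* blockColourings n row) (ΣF-const c (ΣC n (λ col' → ⟦ isPERᵇ n m'' (rel R) ∧ not (containsF n (rel R) (αc col')) ⟧)))) (lsw c (ΣC n (λ col' → ⟦ isPERᵇ n m'' (rel R) ∧ not (containsF n (rel R) (αc col')) ⟧)) (blockColourings n row))) ⟩
      ΣR n (λ R → ΣC n (λ col' → ⟦ isPERᵇ n m'' (rel R) ∧ not (containsF n (rel R) (αc col')) ⟧) * (c * blockColourings n row))
        ≡⟨ ∑-*ʳ (SmR n) (c * blockColourings n row) _ ⟩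
      countAvoiding n m'' * (c * blockColourings n row) ∎
    where
    open ≡-Reasoning
    m'' = maskMinus n m' row
    s : Fin (suc n) → Bool
    s = maskCons true (lookup row)
    G' : Vec (Fin c) (suc n) → ℕ
    G' col = ⟦ not (Pk 3 (suc n) (λ i → s i ∧ αc col i)) ⟧
    F̂ : Rel n → Vec (Fin c) (suc n) → ℕ
    F̂ R col = ⟦ isPERᵇ n m'' (rel R) ∧ not (containsF n (rel R) (αc (tail col))) ⟧
    Φ : BoolRel n → ℕ
    Φ r = ΣF c (λ k → ΣC n (λ col' → ⟦ isPERᵇ n m'' r ∧ not (containsF n r (αc col')) ⟧ * G' (k ∷ col')))
    Φc : ∀ {r r'} → (∀ i j → r i j ≡ r' i j) → Φ r ≡ Φ r'
    Φc {r} {r'} e = ∑-cong (SmF c) (λ k → ∑-cong (SmC n) (λ col' → cong (_* G' (k ∷ col'))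
                     (cong₂ (λ p q → ⟦ p ∧ not q ⟧) (isPERᵇ-cong n {m''} {m''} (λ _ → refl) e) (containsF-cong n (αc col') e))))
    Φ-cong : ∀ R → Φ (λ i j → rel (xorM R (outer row)) i j xor (lookup row i ∧ lookup row j)) ≡ Φ (rel R)
    Φ-cong R = Φc (λ i j → trans (cong (_xor (lookup row i ∧ lookup row j)) (trans (rel-xor R (outer row) i j) (cong (rel R i j xor_) (rel-outer row i j))))
                                  (xor-inv (rel R i j) (lookup row i ∧ lookup row j)))
    lsw : ∀ x y z → (x * y) * z ≡ y * (x * z)
    lsw = solve-∀
    rF : ∀ R → respC (suc n) (λ i → not (s i)) (F̂ R)
    rF R (x ∷ v) (y ∷ w) e with T-dec (isPERᵇ n m'' (rel R))
    ... | inj₂ np rewrite ¬T-false np = refl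
    ... | inj₁ p = cong (λ q → ⟦ isPERᵇ n m'' (rel R) ∧ not q ⟧)
             (contains-resp n m'' (rel R) _ _ (isPERᵇ-sound n p)
                (λ i mi → cong (λ z → Relation.Nullary.Decidable.⌊ z Data.Fin.Properties.≟ a ⌋) (e (suc i) (proj₂ (T∧→ {m' i} mi)))))
    rG : respC (suc n) s G'
    rG v w e = cong (λ q → ⟦ not q ⟧) (Pk-cong 3 (suc n) (λ i → ∧-resp (s i) _ _ (λ si → cong (λ z → Relation.Nullary.Decidable.⌊ z Data.Fin.Properties.≟ a ⌋) (e i si))))

  -- r with the block `row` toggled; for the block of 0 this removes it.
  toggle : ∀ {n} → Vec Bool n → BoolRel n → BoolRel n
  toggle row r i j = r i j xor (lookup row i ∧ lookup row j)

  summand-inside : ∀ n (m : Fin (suc n) → Bool) → m zero ≡ true → ∀ x row cm R' k col' →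
      ⟦ isPERᵇ (suc n) m (rel (build x row cm R')) ∧ not (containsF (suc n) (rel (build x row cm R')) (αc (k ∷ col'))) ⟧
      ≡ (⟦ x ⟧ * (⟦ sameRow n row cm ⟧ * ⟦ ⊆ᵇ n row (m ∘ suc) ⟧))
        * (⟦ isPERᵇ n (maskMinus n (m ∘ suc) row) (toggle row (rel R')) ∧ not (containsF n (toggle row (rel R')) (αc col')) ⟧
           * ⟦ not (Pk 3 (suc n) (λ i → maskCons true (lookup row) i ∧ αc (k ∷ col') i)) ⟧)
  summand-inside n m eq x row cm R' k col' =
    trans (cong₂ (λ p q → ⟦ p ∧ not q ⟧)
                 (trans (isPERᵇ-cong (suc n) em (rel-build x row cm R')) (isPERᵇ-inside n m' x (lookup row) (lookup cm) (rel R')))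
                 (trans (containsF-cong (suc n) (αc (k ∷ col')) (rel-build x row cm R')) (contains-suc n x (lookup row) (lookup cm) (rel R') (αc (k ∷ col')))))
    (boolT x (sameRow n row cm) (⊆ᵇ n row m') (isPERᵇ n (maskMinus n m' row) (toggle row (rel R'))) (αc (k ∷ col') zero)
           (Pk 2 n (λ j → lookup row j ∧ αc col' j)) (Pk 3 n (λ j → lookup row j ∧ αc col' j))
           (containsF n (toggle row (rel R')) (αc col')) (containsF n (rel R') (αc col')) untoggle)
    where
    m' = m ∘ suc
    em : ∀ i → m i ≡ maskCons true m' i
    em zero = eq
    em (suc i) = refl
    -- R' is the toggled relation with the block of 0 merged back in.
    untoggle : T (isPERᵇ n (maskMinus n m' row) (toggle row (rel R')))
             → containsF n (rel R') (αc col') ≡ (Pk 3 n (λ j → lookup row j ∧ αc col' j) ∨ containsF n (toggle row (rel R')) (αc col'))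
    untoggle h = trans (containsF-cong n (αc col') (λ i j → sym (xor-inv (rel R' i j) (lookup row i ∧ lookup row j))))
                       (contains-xor n (toggle row (rel R')) (lookup row) (αc col')
                          (λ i j h' ri → Tnot→ (proj₂ (T∧→ {m' i} (dom (isPERᵇ-sound n {maskMinus n m' row} {toggle row (rel R')} h) i j h'))) ri))

  stepTrue : ∀ n (m : Fin (suc n) → Bool) → m zero ≡ true
    → c ^ suc n * countAvoiding (suc n) m ≡ ΣVB n (λ row → ⟦ ⊆ᵇ n row (λ i → m (suc i)) ⟧ * (countAvoiding n (maskMinus n (λ i → m (suc i)) row) * (c * blockColourings n row)))
  stepTrue n m eq =
    begin
      c ^ suc n * countAvoiding (suc n) m
        ≡⟨ cong (c ^ suc n *_) main ⟩
      c ^ suc n * ΣVB n (λ row → ⟦ ⊆ᵇ n row m' ⟧ * W row)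
        ≡⟨ sym (∑-*ˡ (SmVB n) (c ^ suc n) _) ⟩
      ΣVB n (λ row → c ^ suc n * (⟦ ⊆ᵇ n row m' ⟧ * W row))
        ≡⟨ ∑-cong (SmVB n) (λ row → trans (lsw (c ^ suc n) (⟦ ⊆ᵇ n row m' ⟧) (W row)) (cong (⟦ ⊆ᵇ n row m' ⟧ *_) (blockOfZero-sum n m' row))) ⟩
      ΣVB n (λ row → ⟦ ⊆ᵇ n row m' ⟧ * (countAvoiding n (maskMinus n m' row) * (c * blockColourings n row))) ∎
    where
    open ≡-Reasoning
    m' = λ i → m (suc i)
    lsw : ∀ x y z → x * (y * z) ≡ y * (x * z)
    lsw = solve-∀
    F1 : Vec Bool n → Rel n → Vec (Fin c) n → ℕ
    F1 row R' col' = ⟦ isPERᵇ n (maskMinus n m' row) (toggle row (rel R')) ∧ not (containsF n (toggle row (rel R')) (αc col')) ⟧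
    G : Vec Bool n → Fin c → Vec (Fin c) n → ℕ
    G row k col' = ⟦ not (Pk 3 (suc n) (λ i → maskCons true (lookup row) i ∧ αc (k ∷ col') i)) ⟧
    W : Vec Bool n → ℕ
    W row = ΣR n (λ R' → ΣF c (λ k → ΣC n (λ col' → F1 row R' col' * G row k col')))
    K : Bool → Vec Bool n → Vec Bool n → ℕ
    K x row cm = ⟦ x ⟧ * (⟦ sameRow n row cm ⟧ * ⟦ ⊆ᵇ n row m' ⟧)
    body : Bool → Vec Bool n → Vec Bool n → Rel n → Fin c → Vec (Fin c) n → ℕ
    body x row cm R' k col' = ⟦ isPERᵇ (suc n) m (rel (build x row cm R')) ∧ not (containsF (suc n) (rel (build x row cm R')) (αc (k ∷ col'))) ⟧
    main : countAvoiding (suc n) m ≡ ΣVB n (λ row → ⟦ ⊆ᵇ n row m' ⟧ * W row)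
    main = begin
      countAvoiding (suc n) m
        ≡⟨ ΣR-build n (λ R → ΣC (suc n) (λ col → ⟦ isPERᵇ (suc n) m (rel R) ∧ not (containsF (suc n) (rel R) (αc col)) ⟧)) ⟩
      ΣB (λ x → ΣVB n (λ row → ΣVB n (λ cm → ΣR n (λ R' → ΣF c (λ k → ΣC n (λ col' → body x row cm R' k col'))))))
        ≡⟨ ∑-cong SmB (λ x → ∑-cong (SmVB n) (λ row → ∑-cong (SmVB n) (λ cm → ∑-cong (SmR n) (λ R' → ∑-cong (SmF c) (λ k → ∑-cong (SmC n) (λ col' → summand-inside n m eq x row cm R' k col')))))) ⟩
      ΣB (λ x → ΣVB n (λ row → ΣVB n (λ cm → ΣR n (λ R' → ΣF c (λ k → ΣC n (λ col' → K x row cm * (F1 row R' col' * G row k col')))))))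
        ≡⟨ ∑-cong SmB (λ x → ∑-cong (SmVB n) (λ row → ∑-cong (SmVB n) (λ cm → pullConstant n (K x row cm) (λ R' k col' → F1 row R' col' * G row k col')))) ⟩
      ΣB (λ x → ΣVB n (λ row → ΣVB n (λ cm → K x row cm * W row)))
        ≡⟨ ∑-cong SmB (λ x → ∑-cong (SmVB n) (λ row → cmsum x row)) ⟩
      ΣB (λ x → ΣVB n (λ row → ⟦ x ⟧ * (⟦ ⊆ᵇ n row m' ⟧ * W row)))
        ≡⟨ ∑-cong SmB (λ x → ∑-*ˡ (SmVB n) (⟦ x ⟧) (λ row → ⟦ ⊆ᵇ n row m' ⟧ * W row)) ⟩
      ΣB (λ x → ⟦ x ⟧ * ΣVB n (λ row → ⟦ ⊆ᵇ n row m' ⟧ * W row))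
        ≡⟨ ΣB-sel (λ _ → ΣVB n (λ row → ⟦ ⊆ᵇ n row m' ⟧ * W row)) ⟩
      ΣVB n (λ row → ⟦ ⊆ᵇ n row m' ⟧ * W row) ∎
      where
      r4 : ∀ x e s w → (x * (e * s)) * w ≡ e * (x * (s * w))
      r4 = solve-∀
      cmsum : ∀ x row → ΣVB n (λ cm → K x row cm * W row) ≡ ⟦ x ⟧ * (⟦ ⊆ᵇ n row m' ⟧ * W row)
      cmsum x row = trans (∑-cong (SmVB n) (λ cm → r4 (⟦ x ⟧) (⟦ sameRow n row cm ⟧) (⟦ ⊆ᵇ n row m' ⟧) (W row)))
                   (trans (∑-*ʳ (SmVB n) (⟦ x ⟧ * (⟦ ⊆ᵇ n row m' ⟧ * W row)) (λ cm → ⟦ sameRow n row cm ⟧))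
                          (trans (cong (_* (⟦ x ⟧ * (⟦ ⊆ᵇ n row m' ⟧ * W row))) (ΣVB-eq n row)) (+-identityʳ _)))

  sizeSplit : ∀ n (m : Fin n → Bool) (row : Vec Bool n) → T (⊆ᵇ n row m) → size n m ≡ size n (lookup row) + size n (maskMinus n m row)
  sizeSplit zero m [] h = refl
  sizeSplit (suc n) m (b ∷ row) h with m zero | b
  ... | true | true = cong suc (sizeSplit n (λ i → m (suc i)) row (proj₂ (T∧→ {true} h)))
  ... | true | false = trans (cong suc (sizeSplit n (λ i → m (suc i)) row (proj₂ (T∧→ {true} h)))) (sym (+-suc _ _))
  ... | false | false = sizeSplit n (λ i → m (suc i)) row (proj₂ (T∧→ {true} h))
  ... | false | true = ⊥-elim h

  Closed : ℕ → Set
  Closed n = ∀ (m : Fin n → Bool) → c ^ size n m * countAvoiding n m ≡ c ^ n * avoiders (size n m)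

  blockTerm : ∀ n → Closed n → ∀ (m' : Fin n → Bool) (row : Vec Bool n) →
      c ^ suc (size n m') * (⟦ ⊆ᵇ n row m' ⟧ * (countAvoiding n (maskMinus n m' row) * (c * blockColourings n row)))
      ≡ ⟦ ⊆ᵇ n row m' ⟧ * ((c ^ suc n * c ^ suc n) * (atMost (suc (size n (lookup row))) 2 * avoiders (size n (maskMinus n m' row))))
  blockTerm n IH m' row with T-dec (⊆ᵇ n row m')
  ... | inj₂ ns rewrite ¬T-false ns = *-zeroʳ (c ^ suc (size n m'))
  ... | inj₁ hs rewrite T-true hs | sizeSplit n m' row hs = begin
      c * c ^ (q + l) * (1 * (Rest * (c * Block)))   ≡⟨ cong (λ z → c * z * (1 * (Rest * (c * Block)))) (^-distribˡ-+-* c q l) ⟩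
      c * (c ^ q * c ^ l) * (1 * (Rest * (c * Block))) ≡⟨ regroup c (c ^ q) (c ^ l) Rest Block ⟩
      c * ((c ^ l * Rest) * ((c * c ^ q) * Block))   ≡⟨ cong₂ (λ u v → c * (u * v)) (IH (maskMinus n m' row)) (rowColourings-count 2 (suc n) (maskCons true (lookup row))) ⟩
      c * ((c ^ n * avoiders l) * ((c * c ^ n) * atMost (suc q) 2)) ≡⟨ regroup′ c (c ^ n) (avoiders l) (atMost (suc q) 2) ⟩
      1 * ((c ^ suc n * c ^ suc n) * (atMost (suc q) 2 * avoiders l)) ∎
    where
    open ≡-Reasoning
    q = size n (lookup row)
    l = size n (maskMinus n m' row)
    Rest = countAvoiding n (maskMinus n m' row)
    Block = blockColourings n row
    regroup : ∀ c cq cl x G → (c * (cq * cl)) * (1 * (x * (c * G))) ≡ c * ((cl * x) * ((c * cq) * G))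
    regroup = solve-∀
    regroup′ : ∀ c cn b w → c * ((cn * b) * ((c * cn) * w)) ≡ 1 * (((c * cn) * (c * cn)) * (w * b))
    regroup′ = solve-∀

  countAvoiding-step : ∀ n → Closed n → ∀ (m : Fin (suc n) → Bool) b → m zero ≡ b
    → c ^ (⟦ b ⟧ + size n (m ∘ suc)) * countAvoiding (suc n) m ≡ c ^ suc n * avoiders (⟦ b ⟧ + size n (m ∘ suc))
  countAvoiding-step n IH m false eq = begin
      c ^ size n m' * countAvoiding (suc n) m   ≡⟨ cong (c ^ size n m' *_) (stepFalse n m eq) ⟩
      c ^ size n m' * (c * countAvoiding n m')  ≡⟨ swap (c ^ size n m') c (countAvoiding n m') ⟩
      c * (c ^ size n m' * countAvoiding n m')  ≡⟨ cong (c *_) (IH m') ⟩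
      c * (c ^ n * avoiders (size n m'))        ≡⟨ sym (*-assoc c (c ^ n) _) ⟩
      c ^ suc n * avoiders (size n m') ∎
    where
    open ≡-Reasoning
    m' = m ∘ suc
    swap : ∀ x y z → x * (y * z) ≡ y * (x * z)
    swap = solve-∀
  countAvoiding-step n IH m true eq = *-cancelˡ-≡ _ _ (c ^ suc n) {{m^n≢0 c (suc n)}} (begin
      c ^ suc n * (c ^ suc s * countAvoiding (suc n) m)   ≡⟨ swap (c ^ suc n) (c ^ suc s) (countAvoiding (suc n) m) ⟩
      c ^ suc s * (c ^ suc n * countAvoiding (suc n) m)   ≡⟨ cong (c ^ suc s *_) (stepTrue n m eq) ⟩
      c ^ suc s * ΣVB n (λ row → ⟦ ⊆ᵇ n row m' ⟧ * (countAvoiding n (maskMinus n m' row) * (c * blockColourings n row)))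
        ≡⟨ sym (∑-*ˡ (SmVB n) (c ^ suc s) _) ⟩
      ΣVB n (λ row → c ^ suc s * (⟦ ⊆ᵇ n row m' ⟧ * (countAvoiding n (maskMinus n m' row) * (c * blockColourings n row))))
        ≡⟨ ∑-cong (SmVB n) (blockTerm n IH m') ⟩
      ΣVB n (λ row → ⟦ ⊆ᵇ n row m' ⟧ * g (size n (lookup row)) (size n (maskMinus n m' row)))
        ≡⟨ subsetSum n m' g ⟩
      binConv s g                                          ≡⟨ binConv-scal s K (λ k l → atMost (suc k) 2 * avoiders l) ⟩
      K * binConv s (λ k l → atMost (suc k) 2 * avoiders l) ≡⟨ cong (K *_) (sym (avoiders-rec s)) ⟩
      K * avoiders (suc s)                                  ≡⟨ *-assoc (c ^ suc n) (c ^ suc n) _ ⟩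
      c ^ suc n * (c ^ suc n * avoiders (suc s)) ∎)
    where
    open ≡-Reasoning
    m' = m ∘ suc
    s = size n m'
    K = c ^ suc n * c ^ suc n
    g : ℕ → ℕ → ℕ
    g k l = K * (atMost (suc k) 2 * avoiders l)
    swap : ∀ x y z → x * (y * z) ≡ y * (x * z)
    swap = solve-∀

  countAvoiding-closed : ∀ n → Closed n
  countAvoiding-closed zero m = refl
  countAvoiding-closed (suc n) m = countAvoiding-step n (countAvoiding-closed n) m (m zero) refl


module Enumeration (c' : ℕ) (a : Fin (suc c')) where
  open import Data.Nat using (ℕ; zero; suc; _*_; _^_)
  open import Data.Fin using (Fin; zero)
  open import Data.Bool using (Bool; true; false; _∧_; not; T)
  open import Data.Nat.Properties using (*-cancelˡ-≡; m^n≢0)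
  open import Data.Vec using (Vec)
  open import Data.Product.Algebra using (Σ-assoc-alt)
  open import Relation.Binary.PropositionalEquality
  open import Function.Bundles using (_↔_; mk↔ₛ′)
  open import Function.Construct.Composition using (_↔-∘_)
  open import Defs
  open Booleans
  open FiniteSums
  open PartialEquivalence
  open Containment
  open MatrixSums
  open Colourings c' a
  open BlockRecursion c' a

  -- The full mask: equivalence relations are the PERs with full domain.
  allT : ∀ n → Fin n → Bool
  allT n _ = true

  size-allT : ∀ n → size n (allT n) ≡ n
  size-allT zero = refl
  size-allT (suc n) = cong suc (size-allT n)

  countAvoiding≡avoiders : ∀ n → countAvoiding n (allT n) ≡ avoiders n
  countAvoiding≡avoiders n = *-cancelˡ-≡ _ _ (c ^ n) {{m^n≢0 c n}}
    (subst (λ z → c ^ z * countAvoiding n (allT n) ≡ c ^ n * avoiders z) (size-allT n) (countAvoiding-closed n (allT n)))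

  isEquiv≡ : ∀ n (R : Rel n) → isEquivᵇ R ≡ isPERᵇ n (allT n) (rel R)
  isEquiv≡ n R = cong₂ _∧_ noDomainCondition (cong₂ _∧_ refl' (cong₂ _∧_ sym' trans'))
    where
    noDomainCondition : true ≡ domF n (allT n) (rel R)
    noDomainCondition = sym (trans (allᵇ-cong n (λ i → trans (allᵇ-cong n (λ j → ⇒true (rel R i j))) (allᵇ-true n))) (allᵇ-true n))
      where
      ⇒true : ∀ x → (x ⇒ᵇ true) ≡ true
      ⇒true true = refl
      ⇒true false = refl
    refl' = allF≡allᵇ n _
    sym' = trans (allF≡allᵇ n _) (allᵇ-cong n (λ i → allF≡allᵇ n _))
    trans' = trans (allF≡allᵇ n _) (allᵇ-cong n (λ i → trans (allF≡allᵇ n _) (allᵇ-cong n (λ j → allF≡allᵇ n _))))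

  contains≡ : ∀ n (R : Rel n) (col : Vec (Fin c) n) → contains111ᵇ R col a ≡ containsF n (rel R) (αc col)
  contains≡ n R col = trans (anyF≡anyᵇ n _) (anyᵇ-cong n (λ i → trans (anyF≡anyᵇ n _) (anyᵇ-cong n (λ j → anyF≡anyᵇ n _))))

  T↔⟦⟧ : ∀ b → T b ↔ Fin ⟦ b ⟧
  T↔⟦⟧ true = mk↔ₛ′ (λ _ → zero) (λ _ → _) (λ { zero → refl }) (λ _ → refl)
  T↔⟦⟧ false = mk↔ₛ′ (λ ()) (λ ()) (λ ()) (λ ())

  T-subst : ∀ {b b'} → b ≡ b' → T b ↔ T b'
  T-subst refl = mk↔ₛ′ (λ x → x) (λ x → x) (λ _ → refl) (λ _ → refl)

  iso : ∀ n → AvoidEq111 n c a ↔ Fin (countAvoiding n (allT n))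
  iso n = ∑-↔ (SmR n) _ ↔-∘ (Σ-fib (λ R → ∑-↔ (SmC n) _ ↔-∘ Σ-fib (λ col →
            T↔⟦⟧ _ ↔-∘ T-subst (cong₂ (λ p q → p ∧ not q) (isEquiv≡ n R) (contains≡ n R col)))) ↔-∘ Σ-assoc-alt)


module RationalSums where

  open import Data.Nat as ℕ using (ℕ; zero; suc; _!; _∸_)
  import Data.Nat.Properties as ℕP
  open import Data.Nat.Coprimality using (1-coprimeTo)
  import Data.Nat.Coprimality as Cop
  open import Data.Integer using () renaming (+_ to pos)
  import Data.Integer as ℤ
  import Data.Integer.Properties as ℤP
  open import Data.Rational as ℚ using (ℚ; mkℚ; _+_; _*_; 0ℚ; 1ℚ)
  open import Data.Rational.Properties as ℚP using (normalize-coprime)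
  open import Data.Rational.Solver
  open import Relation.Binary.PropositionalEquality
  open import Defs using (ℕtoℚ; inv!)

  open +-*-Solver

  ι : ℕ → ℚ
  ι = ℕtoℚ

  ι≡ : ∀ m → ι m ≡ mkℚ (pos m) 0 (Cop.sym (1-coprimeTo m))
  ι≡ m = normalize-coprime (Cop.sym (1-coprimeTo m))

  ι-+ : ∀ a b → ι (a ℕ.+ b) ≡ ι a + ι b
  ι-+ a b = trans (cong (ℚ._/ 1) (sym (cong₂ ℤ._+_ (ℤP.*-identityʳ (pos a)) (ℤP.*-identityʳ (pos b))))) (sym (cong₂ _+_ (ι≡ a) (ι≡ b)))

  ι-* : ∀ a b → ι (a ℕ.* b) ≡ ι a * ι b
  ι-* a b = trans (cong (ℚ._/ 1) (ℤP.pos-* a b)) (sym (cong₂ _*_ (ι≡ a) (ι≡ b)))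

  invR : ∀ n → ι (suc n) * (pos 1 ℚ./ suc n) ≡ 1ℚ
  invR n = trans (cong₂ _*_ (ι≡ (suc n)) (normalize-coprime (1-coprimeTo (suc n)))) (ℚP.*-inverseʳ (mkℚ (pos (suc n)) 0 (Cop.sym (1-coprimeTo (suc n)))))

  invK : ∀ k (nz : ℕ.NonZero k) → ι k * (pos 1 ℚ./ k) {{nz}} ≡ 1ℚ
  invK (suc n) nz = invR n

  ι-inv : ∀ m → ι (m !) * inv! m ≡ 1ℚ
  ι-inv m = invK (m !) (m ℕP.!≢0)

  inv-unique : ∀ a x y → a * x ≡ 1ℚ → a * y ≡ 1ℚ → x ≡ y
  inv-unique a x y ex ey = begin
    x               ≡⟨ solve 1 (λ x → x := x :* con 1ℚ) refl x ⟩
    x * 1ℚ          ≡⟨ cong (x *_) (sym ey) ⟩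
    x * (a * y)     ≡⟨ solve 3 (λ a x y → x :* (a :* y) := (a :* x) :* y) refl a x y ⟩
    (a * x) * y     ≡⟨ cong (_* y) ex ⟩
    1ℚ * y          ≡⟨ solve 1 (λ y → con 1ℚ :* y := y) refl y ⟩
    y ∎
    where open ≡-Reasoning

  inv!-suc : ∀ k → ι (suc k) * inv! (suc k) ≡ inv! k
  inv!-suc k = inv-unique (ι (k !)) _ _ e (ι-inv k)
    where
    e : ι (k !) * (ι (suc k) * inv! (suc k)) ≡ 1ℚ
    e = begin
      ι (k !) * (ι (suc k) * inv! (suc k)) ≡⟨ solve 3 (λ a b c → a :* (b :* c) := (b :* a) :* c) refl (ι (k !)) (ι (suc k)) (inv! (suc k)) ⟩
      (ι (suc k) * ι (k !)) * inv! (suc k) ≡⟨ cong (_* inv! (suc k)) (sym (ι-* (suc k) (k !))) ⟩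
      ι (suc k !) * inv! (suc k)            ≡⟨ ι-inv (suc k) ⟩
      1ℚ ∎
      where open ≡-Reasoning

  -- ΣL N f = Σ_{k<N} f k, and Sp s h = Σ_{k+l=s} h k l.

  ΣL : ℕ → (ℕ → ℚ) → ℚ
  ΣL zero f = 0ℚ
  ΣL (suc N) f = f 0 + ΣL N (λ k → f (suc k))

  ΣL-last : ∀ N f → ΣL (suc N) f ≡ ΣL N f + f N
  ΣL-last zero f = solve 1 (λ x → x :+ con 0ℚ := con 0ℚ :+ x) refl (f 0)
  ΣL-last (suc N) f = trans (cong (f 0 +_) (ΣL-last N (λ k → f (suc k))))
    (solve 3 (λ a b c → a :+ (b :+ c) := (a :+ b) :+ c) refl (f 0) (ΣL N (λ k → f (suc k))) (f (suc N)))

  ΣL-cong : ∀ N {f g : ℕ → ℚ} → (∀ k → k ℕ.< N → f k ≡ g k) → ΣL N f ≡ ΣL N g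
  ΣL-cong zero e = refl
  ΣL-cong (suc N) e = cong₂ _+_ (e 0 (ℕ.s≤s ℕ.z≤n)) (ΣL-cong N (λ k p → e (suc k) (ℕ.s≤s p)))

  ΣL-+ : ∀ N f g → ΣL N (λ k → f k + g k) ≡ ΣL N f + ΣL N g
  ΣL-+ zero f g = refl
  ΣL-+ (suc N) f g = trans (cong (f 0 + g 0 +_) (ΣL-+ N _ _))
    (solve 4 (λ a b c d → (a :+ b) :+ (c :+ d) := (a :+ c) :+ (b :+ d)) refl (f 0) (g 0) (ΣL N (λ k → f (suc k))) (ΣL N (λ k → g (suc k))))

  ΣL-scal : ∀ N x f → ΣL N (λ k → x * f k) ≡ x * ΣL N f
  ΣL-scal zero x f = solve 1 (λ x → con 0ℚ := x :* con 0ℚ) refl x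
  ΣL-scal (suc N) x f = trans (cong (x * f 0 +_) (ΣL-scal N x _)) (solve 3 (λ x a b → x :* a :+ x :* b := x :* (a :+ b)) refl x (f 0) (ΣL N (λ k → f (suc k))))

  ΣL-zero : ∀ N → ΣL N (λ _ → 0ℚ) ≡ 0ℚ
  ΣL-zero zero = refl
  ΣL-zero (suc N) = trans (cong (0ℚ +_) (ΣL-zero N)) refl

  Sp : ℕ → (ℕ → ℕ → ℚ) → ℚ
  Sp zero h = h 0 0
  Sp (suc s) h = h 0 (suc s) + Sp s (λ k l → h (suc k) l)

  Sp-ΣL : ∀ s h → Sp s h ≡ ΣL (suc s) (λ k → h k (s ∸ k))
  Sp-ΣL zero h = solve 1 (λ x → x := x :+ con 0ℚ) refl (h 0 0)
  Sp-ΣL (suc s) h = cong (h 0 (suc s) +_) (Sp-ΣL s (λ k l → h (suc k) l))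

  Sp-last : ∀ s h → Sp (suc s) h ≡ Sp s (λ k l → h k (suc l)) + h (suc s) 0
  Sp-last zero h = refl
  Sp-last (suc s) h = trans (cong (h 0 (suc (suc s)) +_) (Sp-last s (λ k l → h (suc k) l)))
    (solve 3 (λ a b c → a :+ (b :+ c) := (a :+ b) :+ c) refl (h 0 (suc (suc s))) (Sp s (λ k l → h (suc k) (suc l))) (h (suc (suc s)) 0))

  Sp-cong : ∀ s {g h : ℕ → ℕ → ℚ} → (∀ k l → k ℕ.+ l ≡ s → g k l ≡ h k l) → Sp s g ≡ Sp s h
  Sp-cong zero e = e 0 0 refl
  Sp-cong (suc s) e = cong₂ _+_ (e 0 (suc s) refl) (Sp-cong s (λ k l p → e (suc k) l (cong suc p)))

  Sp-+ : ∀ s g h → Sp s (λ k l → g k l + h k l) ≡ Sp s g + Sp s h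
  Sp-+ zero g h = refl
  Sp-+ (suc s) g h = trans (cong (g 0 (suc s) + h 0 (suc s) +_) (Sp-+ s _ _))
    (solve 4 (λ a b c d → (a :+ b) :+ (c :+ d) := (a :+ c) :+ (b :+ d)) refl (g 0 (suc s)) (h 0 (suc s)) (Sp s (λ k l → g (suc k) l)) (Sp s (λ k l → h (suc k) l)))

  Sp-scal : ∀ s x h → Sp s (λ k l → x * h k l) ≡ x * Sp s h
  Sp-scal zero x h = refl
  Sp-scal (suc s) x h = trans (cong (x * h 0 (suc s) +_) (Sp-scal s x _)) (solve 3 (λ x a b → x :* a :+ x :* b := x :* (a :+ b)) refl x (h 0 (suc s)) (Sp s (λ k l → h (suc k) l)))

  open Convolution

  Hs : ℕ → (ℕ → ℕ → ℕ) → ℚ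
  Hs s g = Sp s (λ k l → (inv! k * inv! l) * ι (g k l))

  binConv-exponential : ∀ s g → ι (binConv s g) ≡ ι (s !) * Hs s g
  binConv-exponential zero g = solve 1 (λ x → x := con 1ℚ :* ((con 1ℚ :* con 1ℚ) :* x)) refl (ι (g 0 0))
  binConv-exponential (suc s) g = begin
      ι (binConv s g₁ ℕ.+ binConv s g₂)               ≡⟨ ι-+ (binConv s g₁) (binConv s g₂) ⟩
      ι (binConv s g₁) + ι (binConv s g₂)             ≡⟨ cong₂ _+_ (binConv-exponential s g₁) (binConv-exponential s g₂) ⟩
      ι (s !) * Hs s g₁ + ι (s !) * Hs s g₂   ≡⟨ solve 3 (λ a x y → a :* x :+ a :* y := a :* (x :+ y)) refl (ι (s !)) (Hs s g₁) (Hs s g₂) ⟩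
      ι (s !) * (Hs s g₁ + Hs s g₂)           ≡⟨ cong (ι (s !) *_) key ⟩
      ι (s !) * (ι (suc s) * Hs (suc s) g)    ≡⟨ solve 3 (λ a b x → a :* (b :* x) := (b :* a) :* x) refl (ι (s !)) (ι (suc s)) (Hs (suc s) g) ⟩
      (ι (suc s) * ι (s !)) * Hs (suc s) g    ≡⟨ cong (_* Hs (suc s) g) (sym (ι-* (suc s) (s !))) ⟩
      ι (suc s !) * Hs (suc s) g ∎
    where
    open ≡-Reasoning
    g₁ = λ k l → g (suc k) l
    g₂ = λ k l → g k (suc l)
    T : ℕ → ℕ → ℚ
    T k l = (inv! k * inv! l) * ι (g k l)
    pA : Sp (suc s) (λ k l → ι k * T k l) ≡ Hs s g₁
    pA = trans (solve 2 (λ y x → con 0ℚ :* y :+ x := x) refl (T 0 (suc s)) (Sp s (λ k l → ι (suc k) * T (suc k) l)))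
               (Sp-cong s (λ k l _ → trans (solve 4 (λ a b c d → a :* ((b :* c) :* d) := ((a :* b) :* c) :* d) refl (ι (suc k)) (inv! (suc k)) (inv! l) (ι (g (suc k) l)))
                                            (cong (λ z → (z * inv! l) * ι (g (suc k) l)) (inv!-suc k))))
    pB : Sp (suc s) (λ k l → ι l * T k l) ≡ Hs s g₂
    pB = trans (Sp-last s (λ k l → ι l * T k l))
               (trans (solve 2 (λ x y → x :+ con 0ℚ :* y := x) refl (Sp s (λ k l → ι (suc l) * T k (suc l))) (T (suc s) 0))
                      (Sp-cong s (λ k l _ → trans (solve 4 (λ a b c d → a :* ((b :* c) :* d) := ((b :* (a :* c))) :* d) refl (ι (suc l)) (inv! k) (inv! (suc l)) (ι (g k (suc l))))
                                                   (cong (λ z → (inv! k * z) * ι (g k (suc l))) (inv!-suc l)))))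
    key : Hs s g₁ + Hs s g₂ ≡ ι (suc s) * Hs (suc s) g
    key = begin
      Hs s g₁ + Hs s g₂  ≡⟨ cong₂ _+_ (sym pA) (sym pB) ⟩
      Sp (suc s) (λ k l → ι k * T k l) + Sp (suc s) (λ k l → ι l * T k l) ≡⟨ sym (Sp-+ (suc s) (λ k l → ι k * T k l) (λ k l → ι l * T k l)) ⟩
      Sp (suc s) (λ k l → ι k * T k l + ι l * T k l)
        ≡⟨ Sp-cong (suc s) (λ k l e → trans (solve 3 (λ a b t → a :* t :+ b :* t := (a :+ b) :* t) refl (ι k) (ι l) (T k l)) (cong (_* T k l) (trans (sym (ι-+ k l)) (cong ι e)))) ⟩
      Sp (suc s) (λ k l → ι (suc s) * T k l) ≡⟨ Sp-scal (suc s) (ι (suc s)) T ⟩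
      ι (suc s) * Hs (suc s) g ∎


module PartitionSums (u : ℕ → ℚ) where
  open import Data.Rational as ℚ using (ℚ; _+_; _*_; 0ℚ; 1ℚ)

  open import Data.Nat as ℕ using (ℕ; zero; suc; _∸_; _≤_; _<_; z≤n; s≤s; _≤?_; _<ᵇ_)
  import Data.Nat.Properties as ℕP
  open import Data.Bool using (Bool; true; false; if_then_else_)
  open import Data.Rational.Solver
  open import Data.List using (List; []; _∷_; map; _++_; upTo; [_]; filter; concatMap; length)
  open import Data.List.Properties using (map-++; upTo-∷ʳ; filter-++; filter-accept; filter-reject)
  open import Data.List.Relation.Unary.All as All using (All; []; _∷_)
  open import Data.List.Relation.Unary.All.Properties using (all-filter; concat⁺; map⁺)
  open import Data.Product using (_×_; _,_)
  open import Data.Empty using (⊥-elim)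
  open import Relation.Nullary using (¬_)
  open import Relation.Binary.Definitions using (tri<; tri≈; tri>)
  open import Relation.Binary.PropositionalEquality hiding ([_])
  open import Defs using (partitionsF; mult; inv!; sumℚ; prodℚ)
  open RationalSums

  open +-*-Solver

  sum-++ : ∀ xs ys → sumℚ (xs ++ ys) ≡ sumℚ xs + sumℚ ys
  sum-++ [] ys = solve 1 (λ y → y := con 0ℚ :+ y) refl (sumℚ ys)
  sum-++ (x ∷ xs) ys = trans (cong (x +_) (sum-++ xs ys)) (solve 3 (λ a b c → a :+ (b :+ c) := (a :+ b) :+ c) refl x (sumℚ xs) (sumℚ ys))

  prod-++ : ∀ xs ys → prodℚ (xs ++ ys) ≡ prodℚ xs * prodℚ ys
  prod-++ [] ys = solve 1 (λ y → y := con 1ℚ :* y) refl (prodℚ ys)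
  prod-++ (x ∷ xs) ys = trans (cong (x *_) (prod-++ xs ys)) (solve 3 (λ a b c → a :* (b :* c) := (a :* b) :* c) refl x (prodℚ xs) (prodℚ ys))

  sum-concatMap : ∀ {A B : Set} (h : B → ℚ) (g : A → List B) xs → sumℚ (map h (concatMap g xs)) ≡ sumℚ (map (λ x → sumℚ (map h (g x))) xs)
  sum-concatMap h g [] = refl
  sum-concatMap h g (x ∷ xs) = trans (cong sumℚ (map-++ h (g x) (concatMap g xs)))
    (trans (sum-++ (map h (g x)) _) (cong (sumℚ (map h (g x)) +_) (sum-concatMap h g xs)))

  sum-cong : ∀ {A : Set} {h h' : A → ℚ} {xs} → All (λ x → h x ≡ h' x) xs → sumℚ (map h xs) ≡ sumℚ (map h' xs)
  sum-cong [] = refl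
  sum-cong (e ∷ es) = cong₂ _+_ e (sum-cong es)

  sum-cong' : ∀ {A : Set} {h h' : A → ℚ} xs → (∀ x → h x ≡ h' x) → sumℚ (map h xs) ≡ sumℚ (map h' xs)
  sum-cong' [] e = refl
  sum-cong' (x ∷ xs) e = cong₂ _+_ (e x) (sum-cong' xs e)

  sum-scalʳ : ∀ {A : Set} (h : A → ℚ) c xs → sumℚ (map (λ x → h x * c) xs) ≡ sumℚ (map h xs) * c
  sum-scalʳ h c [] = solve 1 (λ c → con 0ℚ := con 0ℚ :* c) refl c
  sum-scalʳ h c (x ∷ xs) = trans (cong (h x * c +_) (sum-scalʳ h c xs)) (solve 3 (λ a b c → a :* c :+ b :* c := (a :+ b) :* c) refl (h x) (sumℚ (map h xs)) c)

  sum-scalˡ : ∀ {A : Set} (h : A → ℚ) c xs → sumℚ (map (λ x → c * h x) xs) ≡ c * sumℚ (map h xs)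
  sum-scalˡ h c [] = solve 1 (λ c → con 0ℚ := c :* con 0ℚ) refl c
  sum-scalˡ h c (x ∷ xs) = trans (cong (c * h x +_) (sum-scalˡ h c xs)) (solve 3 (λ a b c → c :* a :+ c :* b := c :* (a :+ b)) refl (h x) (sumℚ (map h xs)) c)

  -- The weight of a partition p with parts ≤ m, where the multiplicity of
  -- the largest allowed part m is shifted by r:
  --   W m r p = Π u(pᵢ) · Π_{i<m} 1/#p(i)! · 1/(#p(m)+r)!.
  -- E f n m r sums it over the partitions of n with parts ≤ m (fuel f).

  U : List ℕ → ℚ
  U p = prodℚ (map u p)

  Pm : ℕ → List ℕ → ℚ
  Pm k p = prodℚ (map (λ i → inv! (mult p i)) (map suc (upTo k)))

  W : ℕ → ℕ → List ℕ → ℚ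
  W m r p = U p * (Pm (ℕ.pred m) p * inv! (mult p m ℕ.+ r))

  E : ℕ → ℕ → ℕ → ℕ → ℚ
  E f n m r = sumℚ (map (W m r) (partitionsF f n m))

  Pm-last : ∀ k p → Pm (suc k) p ≡ Pm k p * inv! (mult p (suc k))
  Pm-last k p = begin
    Pm (suc k) p ≡⟨ cong (λ z → prodℚ (map (λ i → inv! (mult p i)) (map suc z))) (sym (upTo-∷ʳ k)) ⟩
    prodℚ (map g (map suc (upTo k ++ [ k ])))  ≡⟨ cong (λ z → prodℚ (map g z)) (map-++ suc (upTo k) [ k ]) ⟩
    prodℚ (map g (map suc (upTo k) ++ [ suc k ])) ≡⟨ cong prodℚ (map-++ g (map suc (upTo k)) [ suc k ]) ⟩
    prodℚ (map g (map suc (upTo k)) ++ [ g (suc k) ]) ≡⟨ prod-++ (map g (map suc (upTo k))) [ g (suc k) ] ⟩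
    Pm k p * (g (suc k) * 1ℚ) ≡⟨ cong (Pm k p *_) (solve 1 (λ x → x :* con 1ℚ := x) refl (g (suc k))) ⟩
    Pm k p * g (suc k) ∎
    where
    open ≡-Reasoning
    g = λ i → inv! (mult p i)

  mult-≢ : ∀ s q i → ¬ (s ≡ i) → mult (s ∷ q) i ≡ mult q i
  mult-≢ s q i ne = cong length (filter-reject (λ x → x ℕ.≟ i) ne)

  mult-≡ : ∀ s q → mult (s ∷ q) s ≡ suc (mult q s)
  mult-≡ s q = cong length (filter-accept (λ x → x ℕ.≟ s) refl)

  Pm-cons : ∀ k s q → k < s → Pm k (s ∷ q) ≡ Pm k q
  Pm-cons zero s q _ = refl
  Pm-cons (suc k) s q lt = begin
    Pm (suc k) (s ∷ q) ≡⟨ Pm-last k (s ∷ q) ⟩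
    Pm k (s ∷ q) * inv! (mult (s ∷ q) (suc k)) ≡⟨ cong₂ _*_ (Pm-cons k s q (ℕP.<-trans (ℕP.n<1+n k) lt)) (cong inv! (mult-≢ s q (suc k) (λ e → ℕP.<-irrefl (sym e) lt))) ⟩
    Pm k q * inv! (mult q (suc k)) ≡⟨ sym (Pm-last k q) ⟩
    Pm (suc k) q ∎
    where open ≡-Reasoning

  Pm-nil : ∀ k → Pm k [] ≡ 1ℚ
  Pm-nil zero = refl
  Pm-nil (suc k) = trans (Pm-last k []) (trans (cong (_* 1ℚ) (Pm-nil k)) refl)

  W-cons : ∀ m' r q → W (suc m') r (suc m' ∷ q) ≡ u (suc m') * W (suc m') (suc r) q
  W-cons m' r q = begin
    (u (suc m') * U q) * (Pm m' (suc m' ∷ q) * inv! (mult (suc m' ∷ q) (suc m') ℕ.+ r))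
      ≡⟨ cong₂ (λ a b → (u (suc m') * U q) * (a * inv! b)) (Pm-cons m' (suc m') q (ℕP.n<1+n m'))
               (trans (cong (ℕ._+ r) (mult-≡ (suc m') q)) (sym (ℕP.+-suc (mult q (suc m')) r))) ⟩
    (u (suc m') * U q) * (Pm m' q * inv! (mult q (suc m') ℕ.+ suc r))
      ≡⟨ solve 3 (λ a b c → (a :* b) :* c := a :* (b :* c)) refl (u (suc m')) (U q) (Pm m' q * inv! (mult q (suc m') ℕ.+ suc r)) ⟩
    u (suc m') * W (suc m') (suc r) q ∎
    where open ≡-Reasoning

  partsOK : ℕ → List ℕ → Set
  partsOK m p = All (λ x → 1 ≤ x × x ≤ m) p

  mult-big : ∀ m p → partsOK m p → mult p (suc m) ≡ 0
  mult-big m [] _ = refl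
  mult-big m (x ∷ p) ((_ , x≤m) ∷ ok) = trans (mult-≢ x p (suc m) (λ e → ℕP.1+n≰n (subst (_≤ m) e x≤m))) (mult-big m p ok)

  W-lower : ∀ m' r p → partsOK m' p → W (suc m') r p ≡ W m' 0 p * inv! r
  W-lower zero r [] ok = solve 1 (λ x → con 1ℚ :* (con 1ℚ :* x) := (con 1ℚ :* (con 1ℚ :* con 1ℚ)) :* x) refl (inv! r)
  W-lower zero r (x ∷ p) ((1≤x , x≤0) ∷ _) = ⊥-elim (ℕP.<-irrefl refl (ℕP.≤-trans 1≤x x≤0))
  W-lower (suc m'') r p ok = begin
    U p * (Pm (suc m'') p * inv! (mult p (suc (suc m'')) ℕ.+ r))
      ≡⟨ cong₂ (λ a b → U p * (a * inv! (b ℕ.+ r))) (Pm-last m'' p) (mult-big (suc m'') p ok) ⟩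
    U p * ((Pm m'' p * inv! (mult p (suc m''))) * inv! r)
      ≡⟨ cong (λ z → U p * ((Pm m'' p * inv! z) * inv! r)) (sym (ℕP.+-identityʳ (mult p (suc m'')))) ⟩
    U p * ((Pm m'' p * inv! (mult p (suc m'') ℕ.+ 0)) * inv! r)
      ≡⟨ solve 4 (λ a b c d → a :* ((b :* c) :* d) := (a :* (b :* c)) :* d) refl (U p) (Pm m'' p) (inv! (mult p (suc m'') ℕ.+ 0)) (inv! r) ⟩
    W (suc m'') 0 p * inv! r ∎
    where open ≡-Reasoning

  -- The recursion of partitionsF in its last argument: a partition with
  -- parts ≤ m+1 either has all parts ≤ m or starts with the part m+1.

  firstParts : ℕ → ℕ → List ℕ
  firstParts N m = filter (λ k → suc k ≤? m) (upTo N)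

  firstParts-step : ∀ N m → firstParts (suc N) m ≡ firstParts N m ++ filter (λ k → suc k ≤? m) [ N ]
  firstParts-step N m = trans (cong (filter (λ k → suc k ≤? m)) (sym (upTo-∷ʳ N))) (filter-++ (λ k → suc k ≤? m) (upTo N) [ N ])

  firstParts-zero : ∀ N → firstParts N 0 ≡ []
  firstParts-zero zero = refl
  firstParts-zero (suc N) = trans (firstParts-step N 0) (trans (cong (_++ _) (firstParts-zero N)) (filter-reject (λ k → suc k ≤? 0) {N} {[]} (λ ())))

  opt : Bool → ℕ → List ℕ
  opt b x = if b then [ x ] else []

  filter-single : ∀ N m → filter (λ k → suc k ≤? m) [ N ] ≡ opt (N <ᵇ m) N
  filter-single N m = go (N <ᵇ m) refl
    where
    go : ∀ b → (N <ᵇ m) ≡ b → filter (λ k → suc k ≤? m) [ N ] ≡ opt b N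
    go true eq = filter-accept (λ k → suc k ≤? m) (ℕP.<ᵇ⇒< N m (subst Data.Bool.T (sym eq) _))
    go false eq = filter-reject (λ k → suc k ≤? m) (λ lt → subst Data.Bool.T eq (ℕP.<⇒<ᵇ lt))

  <ᵇ-true : ∀ {x y} → x < y → (x <ᵇ y) ≡ true
  <ᵇ-true {x} {y} lt with x <ᵇ y | ℕP.<⇒<ᵇ lt
  ... | true | _ = refl

  <ᵇ-false : ∀ {x y} → ¬ (x < y) → (x <ᵇ y) ≡ false
  <ᵇ-false {x} {y} nlt with x <ᵇ y in eq
  ... | true = ⊥-elim (nlt (ℕP.<ᵇ⇒< x y (subst Data.Bool.T (sym eq) _)))
  ... | false = refl

  firstParts-suc : ∀ N m' → firstParts N (suc m') ≡ firstParts N m' ++ opt (m' <ᵇ N) m'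
  firstParts-suc zero m' = refl
  firstParts-suc (suc N) m' = begin
    firstParts (suc N) (suc m') ≡⟨ firstParts-step N (suc m') ⟩
    firstParts N (suc m') ++ filter (λ k → suc k ≤? suc m') [ N ] ≡⟨ cong₂ _++_ (firstParts-suc N m') (filter-single N (suc m')) ⟩
    (firstParts N m' ++ opt (m' <ᵇ N) m') ++ opt (N <ᵇ suc m') N ≡⟨ Data.List.Properties.++-assoc (firstParts N m') _ _ ⟩
    firstParts N m' ++ (opt (m' <ᵇ N) m' ++ opt (N <ᵇ suc m') N) ≡⟨ cong (firstParts N m' ++_) (tri N m') ⟩
    firstParts N m' ++ (opt (N <ᵇ m') N ++ opt (m' <ᵇ suc N) m') ≡⟨ sym (Data.List.Properties.++-assoc (firstParts N m') _ _) ⟩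
    (firstParts N m' ++ opt (N <ᵇ m') N) ++ opt (m' <ᵇ suc N) m' ≡⟨ cong (_++ opt (m' <ᵇ suc N) m') (sym (trans (firstParts-step N m') (cong (firstParts N m' ++_) (filter-single N m')))) ⟩
    firstParts (suc N) m' ++ opt (m' <ᵇ suc N) m' ∎
    where
    open ≡-Reasoning
    tri : ∀ N m' → opt (m' <ᵇ N) m' ++ opt (N <ᵇ suc m') N ≡ opt (N <ᵇ m') N ++ opt (m' <ᵇ suc N) m'
    tri N m' with ℕP.<-cmp N m'
    ... | tri< lt _ _ rewrite <ᵇ-true lt | <ᵇ-false (ℕP.<⇒≯ lt) | <ᵇ-true (ℕP.m<n⇒m<1+n lt) | <ᵇ-false (λ h → ℕP.<⇒≯ lt (ℕP.≤∧≢⇒< (ℕP.≤-pred h) (λ e → ℕP.<-irrefl (sym e) lt))) = refl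
    ... | tri≈ _ refl _ rewrite <ᵇ-false (ℕP.<-irrefl {N} refl) | <ᵇ-true (ℕP.n<1+n N) = refl
    ... | tri> _ _ gt rewrite <ᵇ-true gt | <ᵇ-false (ℕP.<⇒≯ gt) | <ᵇ-true (ℕP.m<n⇒m<1+n gt) | <ᵇ-false (λ h → ℕP.<⇒≯ gt (ℕP.≤∧≢⇒< (ℕP.≤-pred h) (λ e → ℕP.<-irrefl (sym e) gt))) = refl


  withFirst : ℕ → ℕ → ℕ → List (List ℕ)
  withFirst f n k = map (suc k ∷_) (partitionsF f (n ∸ k) (suc k))

  concatMap-++' : ∀ {A B : Set} (g : A → List B) xs ys → concatMap g (xs ++ ys) ≡ concatMap g xs ++ concatMap g ys
  concatMap-++' g [] ys = refl
  concatMap-++' g (x ∷ xs) ys = trans (cong (g x ++_) (concatMap-++' g xs ys)) (sym (Data.List.Properties.++-assoc (g x) _ _))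

  oif : Bool → ℚ → ℚ
  oif true x = x
  oif false x = 0ℚ

  PF-ok : ∀ f n m → All (partsOK m) (partitionsF f n m)
  PF-ok f zero m = [] ∷ []
  PF-ok zero (suc n) m = []
  PF-ok (suc f) (suc n) m = concat⁺ (map⁺ (All.map (λ {k} le → map⁺ (All.map (λ {q} ok → (s≤s z≤n , le) ∷ All.map (λ {x} (a , b) → a , ℕP.≤-trans b le) ok) (PF-ok f (n ∸ k) (suc k)))) (all-filter (λ k → suc k ≤? m) (upTo (suc n)))))

  E-rec : ∀ f n m' r → E (suc f) (suc n) (suc m') r ≡ E (suc f) (suc n) m' 0 * inv! r + oif (m' <ᵇ suc n) (u (suc m') * E f (n ∸ m') (suc m') (suc r))
  E-rec f n m' r = begin
    sumℚ (map (W (suc m') r) (concatMap (withFirst f n) (firstParts (suc n) (suc m'))))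
      ≡⟨ cong (λ z → sumℚ (map (W (suc m') r) (concatMap (withFirst f n) z))) (firstParts-suc (suc n) m') ⟩
    sumℚ (map (W (suc m') r) (concatMap (withFirst f n) (firstParts (suc n) m' ++ opt (m' <ᵇ suc n) m')))
      ≡⟨ cong (λ z → sumℚ (map (W (suc m') r) z)) (concatMap-++' (withFirst f n) (firstParts (suc n) m') _) ⟩
    sumℚ (map (W (suc m') r) (partitionsF (suc f) (suc n) m' ++ concatMap (withFirst f n) (opt (m' <ᵇ suc n) m')))
      ≡⟨ cong sumℚ (map-++ (W (suc m') r) (partitionsF (suc f) (suc n) m') _) ⟩
    sumℚ (map (W (suc m') r) (partitionsF (suc f) (suc n) m') ++ map (W (suc m') r) (concatMap (withFirst f n) (opt (m' <ᵇ suc n) m')))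
      ≡⟨ sum-++ (map (W (suc m') r) (partitionsF (suc f) (suc n) m')) _ ⟩
    sumℚ (map (W (suc m') r) (partitionsF (suc f) (suc n) m')) + sumℚ (map (W (suc m') r) (concatMap (withFirst f n) (opt (m' <ᵇ suc n) m')))
      ≡⟨ cong₂ _+_ part1 (part2 (m' <ᵇ suc n)) ⟩
    E (suc f) (suc n) m' 0 * inv! r + oif (m' <ᵇ suc n) (u (suc m') * E f (n ∸ m') (suc m') (suc r)) ∎
    where
    open ≡-Reasoning
    part1 : sumℚ (map (W (suc m') r) (partitionsF (suc f) (suc n) m')) ≡ E (suc f) (suc n) m' 0 * inv! r
    part1 = trans (sum-cong (All.map (λ {p} ok → W-lower m' r p ok) (PF-ok (suc f) (suc n) m'))) (sum-scalʳ (W m' 0) (inv! r) (partitionsF (suc f) (suc n) m'))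
    part2 : ∀ b → sumℚ (map (W (suc m') r) (concatMap (withFirst f n) (opt b m'))) ≡ oif b (u (suc m') * E f (n ∸ m') (suc m') (suc r))
    part2 false = refl
    part2 true = begin
      sumℚ (map (W (suc m') r) (withFirst f n m' ++ [])) ≡⟨ cong (λ z → sumℚ (map (W (suc m') r) z)) (Data.List.Properties.++-identityʳ (withFirst f n m')) ⟩
      sumℚ (map (W (suc m') r) (map (suc m' ∷_) X)) ≡⟨ cong sumℚ (sym (Data.List.Properties.map-∘ X)) ⟩
      sumℚ (map (λ q → W (suc m') r (suc m' ∷ q)) X) ≡⟨ sum-cong' X (W-cons m' r) ⟩
      sumℚ (map (λ q → u (suc m') * W (suc m') (suc r) q) X) ≡⟨ sum-scalˡ (W (suc m') (suc r)) (u (suc m')) X ⟩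
      u (suc m') * E f (n ∸ m') (suc m') (suc r) ∎
      where X = partitionsF f (n ∸ m') (suc m')

  E-zero : ∀ f m r → E f 0 m r ≡ inv! r
  E-zero f m r = trans (cong (λ z → (1ℚ * (z * inv! r)) + 0ℚ) (Pm-nil (ℕ.pred m)))
                       (solve 1 (λ x → (con 1ℚ :* (con 1ℚ :* x)) :+ con 0ℚ := x) refl (inv! r))

  E-suc0 : ∀ f n r → E f (suc n) 0 r ≡ 0ℚ
  E-suc0 zero n r = refl
  E-suc0 (suc f) n r = cong (λ z → sumℚ (map (W 0 r) (concatMap (withFirst f n) z))) (firstParts-zero (suc n))

  E-fuel : ∀ f f' n m r → n ≤ f → n ≤ f' → E f n m r ≡ E f' n m r
  E-fuel f f' zero m r _ _ = trans (E-zero f m r) (sym (E-zero f' m r))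
  E-fuel (suc g) (suc g') (suc n) zero r _ _ = trans (E-suc0 (suc g) n r) (sym (E-suc0 (suc g') n r))
  E-fuel (suc g) (suc g') (suc n) (suc m') r (s≤s p) (s≤s q) =
    trans (E-rec g n m' r)
    (trans (cong₂ (λ a b → a * inv! r + oif (m' <ᵇ suc n) (u (suc m') * b))
                  (E-fuel (suc g) (suc g') (suc n) m' 0 (s≤s p) (s≤s q))
                  (E-fuel g g' (n ∸ m') (suc m') (suc r) (ℕP.≤-trans (ℕP.m∸n≤m n m') p) (ℕP.≤-trans (ℕP.m∸n≤m n m') q)))
           (sym (E-rec g' n m' r)))

  F : ℕ → ℕ → ℕ → ℚ
  F n m r = E n n m r

  F-zero : ∀ m r → F 0 m r ≡ inv! r
  F-zero m r = E-zero 0 m r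

  F-suc0 : ∀ n r → F (suc n) 0 r ≡ 0ℚ
  F-suc0 n r = E-suc0 (suc n) n r

  F-rec : ∀ n m' r → F (suc n) (suc m') r ≡ F (suc n) m' 0 * inv! r + oif (m' <ᵇ suc n) (u (suc m') * F (n ∸ m') (suc m') (suc r))
  F-rec n m' r = trans (E-rec n n m' r) (cong (λ b → F (suc n) m' 0 * inv! r + oif (m' <ᵇ suc n) (u (suc m') * b))
                                             (E-fuel n (n ∸ m') (n ∸ m') (suc m') (suc r) (ℕP.m∸n≤m n m') ℕP.≤-refl))


module DerivativeIdentity (u : ℕ → ℚ) where
  open import Data.Rational as ℚ using (ℚ; _+_; _*_; _-_; 0ℚ; 1ℚ)

  open import Data.Nat as ℕ using (ℕ; zero; suc; _∸_; _≤_; s≤s; _≤ᵇ_; _<ᵇ_)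
  import Data.Nat.Properties as ℕP
  open import Data.Bool using (Bool; true; false)
  open import Data.Empty using (⊥-elim)
  import Data.Bool
  open import Data.Rational.Solver
  open import Relation.Binary.PropositionalEquality
  open import Defs using (inv!)
  open RationalSums
  open PartitionSums u

  open +-*-Solver

  Fs : ℕ → ℕ → ℕ → ℕ → ℚ
  Fs n i m r = oif (i ≤ᵇ n) (F (n ∸ i) m r)

  FR : ∀ n m' r → F n (suc m') r ≡ F n m' 0 * inv! r + u (suc m') * Fs n (suc m') (suc m') (suc r)
  FR zero m' r = trans (F-zero (suc m') r) (sym (trans (cong (λ z → z * inv! r + u (suc m') * 0ℚ) (F-zero m' 0))
                    (solve 2 (λ x v → con 1ℚ :* x :+ v :* con 0ℚ := x) refl (inv! r) (u (suc m')))))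
  FR (suc n) m' r = trans (F-rec n m' r) (cong (F (suc n) m' 0 * inv! r +_) (oif-u (m' <ᵇ suc n)))
    where
    oif-u : ∀ b → oif b (u (suc m') * F (n ∸ m') (suc m') (suc r)) ≡ u (suc m') * oif b (F (n ∸ m') (suc m') (suc r))
    oif-u true = refl
    oif-u false = solve 1 (λ v → con 0ℚ := v :* con 0ℚ) refl (u (suc m'))

  leb-suc : ∀ a n → (suc a ≤ᵇ suc n) ≡ (a ≤ᵇ n)
  leb-suc zero n = refl
  leb-suc (suc a) n = refl

  oif-nest : ∀ a b n (X : ℕ → ℚ) → oif (a ≤ᵇ n) (oif (b ≤ᵇ n ∸ a) (X (n ∸ a ∸ b))) ≡ oif (a ℕ.+ b ≤ᵇ n) (X (n ∸ (a ℕ.+ b)))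
  oif-nest zero b n X = refl
  oif-nest (suc a) b zero X = refl
  oif-nest (suc a) b (suc n) X rewrite leb-suc a n | leb-suc (a ℕ.+ b) n = oif-nest a b n X

  swap : ∀ n j M r' → oif (suc j ≤ᵇ n) (Fs (n ∸ suc j) M M r') ≡ oif (M ≤ᵇ n) (Fs (n ∸ M) (suc j) M r')
  swap n j M r' = trans (oif-nest (suc j) M n (λ x → F x M r'))
                        (trans (cong (λ z → oif (z ≤ᵇ n) (F (n ∸ z) M r')) (ℕP.+-comm (suc j) M))
                               (sym (oif-nest M (suc j) n (λ x → F x M r'))))

  ∸-bound : ∀ n m' K' → suc m' ≤ n → n ≤ suc K' → n ∸ suc m' ≤ K'
  ∸-bound (suc n') m' K' _ (s≤s le) = ℕP.≤-trans (ℕP.m∸n≤m n' m') le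


  -- The derivative identity of the exponential formula, refined to parts
  -- ≤ m (Stmt n m r); for m = n and r = 0 it reads
  --   n · e n = Σ_{j<n} (j+1) u(j+1) e(n-1-j)   (see `derivative`).
  Stmt : ℕ → ℕ → ℕ → Set
  Stmt n m r = ι n * F n m r + ι m * u m * ι r * Fs n m m (suc r) ≡ ΣL m (λ j → ι (suc j) * u (suc j) * Fs n (suc j) m r)

  oif-lin : ∀ b x i y z → oif b (x * i + y * z) ≡ oif b x * i + y * oif b z
  oif-lin true x i y z = refl
  oif-lin false x i y z = solve 2 (λ i y → con 0ℚ := con 0ℚ :* i :+ y :* con 0ℚ) refl i y

  ΣL-oif : ∀ N b (t X : ℕ → ℚ) → ΣL N (λ j → t j * oif b (X j)) ≡ oif b (ΣL N (λ j → t j * X j))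
  ΣL-oif N true t X = refl
  ΣL-oif N false t X = trans (ΣL-cong N (λ j _ → solve 1 (λ x → x :* con 0ℚ := con 0ℚ) refl (t j))) (ΣL-zero N)

  sub-lem : ∀ X B Y → X ≡ B + Y → B ≡ X - Y
  sub-lem X B Y e = trans (solve 2 (λ B Y → B := (B :+ Y) :- Y) refl B Y) (cong (_- Y) (sym e))

  alg : ∀ (ιN ιM ιr v Gn GN b c i1 B2 : ℚ) {ιn ιs i0 Fn F1 F0 A1 : ℚ}
    → ιn ≡ ιN + ιM → ιs ≡ 1ℚ + ιr → i0 ≡ ιs * i1 → F1 ≡ GN * i1 + v * c → Fn ≡ Gn * i0 + v * F1 → F0 ≡ GN * i0 + v * b
    → A1 ≡ ιn * Gn → B2 ≡ (ιN * F1 + ιM * v * ιs * c) - ιM * v * b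
    → ιn * Fn + ιM * v * ιr * F1 ≡ (i0 * A1 + v * B2) + ιM * v * F0
  alg ιN ιM ιr v Gn GN b c i1 B2 refl refl refl refl refl refl refl e8 rewrite e8 =
    solve 9 (λ ιN ιM ιr v Gn GN b c i1 →
      (ιN :+ ιM) :* (Gn :* ((con 1ℚ :+ ιr) :* i1) :+ v :* (GN :* i1 :+ v :* c)) :+ ιM :* v :* ιr :* (GN :* i1 :+ v :* c)
      := (((con 1ℚ :+ ιr) :* i1) :* ((ιN :+ ιM) :* Gn) :+ v :* ((ιN :* (GN :* i1 :+ v :* c) :+ ιM :* v :* (con 1ℚ :+ ιr) :* c) :- ιM :* v :* b))
         :+ ιM :* v :* (GN :* ((con 1ℚ :+ ιr) :* i1) :+ v :* b)) refl ιN ιM ιr v Gn GN b c i1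

  -- The inductive step for Stmt n (m'+1) r, given the statement for parts
  -- ≤ m' (IH≤m'): the right-hand side splits into the partitions with all
  -- parts ≤ m' and those with a largest part m'+1 (RHS≡).
  module Step (m' n r : ℕ) (IH≤m' : Stmt n m' 0) where
    M = suc m'
    uM = u M
    G' : ℕ → ℚ
    G' x = F x m' 0
    t : ℕ → ℚ
    t j = ι (suc j) * u (suc j)
    A1 = ΣL m' (λ j → t j * Fs n (suc j) m' 0)
    IHo : ι n * G' n ≡ A1
    IHo = trans (solve 4 (λ a x v y → a := a :+ x :* v :* con 0ℚ :* y) refl (ι n * G' n) (ι m') (u m') (Fs n m' m' 1)) IH≤m'
    pt : ∀ j → t j * Fs n (suc j) M r ≡ inv! r * (t j * Fs n (suc j) m' 0) + uM * (t j * oif (suc j ≤ᵇ n) (Fs (n ∸ suc j) M M (suc r)))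
    pt j = begin
      t j * oif (suc j ≤ᵇ n) (F (n ∸ suc j) M r)
        ≡⟨ cong (λ z → t j * oif (suc j ≤ᵇ n) z) (FR (n ∸ suc j) m' r) ⟩
      t j * oif (suc j ≤ᵇ n) (G' (n ∸ suc j) * inv! r + uM * Fs (n ∸ suc j) M M (suc r))
        ≡⟨ cong (t j *_) (oif-lin (suc j ≤ᵇ n) (G' (n ∸ suc j)) (inv! r) uM (Fs (n ∸ suc j) M M (suc r))) ⟩
      t j * (Fs n (suc j) m' 0 * inv! r + uM * oif (suc j ≤ᵇ n) (Fs (n ∸ suc j) M M (suc r)))
        ≡⟨ solve 5 (λ t a i v b → t :* (a :* i :+ v :* b) := i :* (t :* a) :+ v :* (t :* b)) refl (t j) (Fs n (suc j) m' 0) (inv! r) uM (oif (suc j ≤ᵇ n) (Fs (n ∸ suc j) M M (suc r))) ⟩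
      inv! r * (t j * Fs n (suc j) m' 0) + uM * (t j * oif (suc j ≤ᵇ n) (Fs (n ∸ suc j) M M (suc r))) ∎
      where open ≡-Reasoning
    B1 = ΣL m' (λ j → t j * oif (suc j ≤ᵇ n) (Fs (n ∸ suc j) M M (suc r)))
    B1≡ : B1 ≡ oif (M ≤ᵇ n) (ΣL m' (λ j → t j * Fs (n ∸ M) (suc j) M (suc r)))
    B1≡ = trans (ΣL-cong m' (λ j _ → cong (t j *_) (swap n j M (suc r)))) (ΣL-oif m' (M ≤ᵇ n) t (λ j → Fs (n ∸ M) (suc j) M (suc r)))
    RHS≡ : ΣL M (λ j → t j * Fs n (suc j) M r) ≡ (inv! r * A1 + uM * B1) + ι M * uM * Fs n M M r
    RHS≡ = begin
      ΣL M (λ j → t j * Fs n (suc j) M r) ≡⟨ ΣL-last m' _ ⟩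
      ΣL m' (λ j → t j * Fs n (suc j) M r) + t m' * Fs n M M r
        ≡⟨ cong (_+ t m' * Fs n M M r) (trans (ΣL-cong m' (λ j _ → pt j)) (trans (ΣL-+ m' _ _) (cong₂ _+_ (ΣL-scal m' (inv! r) _) (ΣL-scal m' uM _)))) ⟩
      (inv! r * A1 + uM * B1) + t m' * Fs n M M r
        ≡⟨ cong (λ z → (inv! r * A1 + uM * B1) + z) (solve 3 (λ a b c → a :* b :* c := a :* b :* c) refl (ι M) uM (Fs n M M r)) ⟩
      (inv! r * A1 + uM * B1) + ι M * uM * Fs n M M r ∎
      where open ≡-Reasoning

    -- Case m'+1 > n: no part m'+1 fits.
    small : (M ≤ᵇ n) ≡ false → Stmt n M r
    small eq = begin
        ι n * F n M r + ι M * uM * ι r * Fs n M M (suc r)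
          ≡⟨ cong (λ z → ι n * z + ι M * uM * ι r * Fs n M M (suc r)) (FR n m' r) ⟩
        ι n * (G' n * inv! r + uM * Fs n M M (suc r)) + ι M * uM * ι r * Fs n M M (suc r)
          ≡⟨ cong (λ z → ι n * (G' n * inv! r + uM * oif z (F (n ∸ M) M (suc r))) + ι M * uM * ι r * oif z (F (n ∸ M) M (suc r))) eq ⟩
        ι n * (G' n * inv! r + uM * 0ℚ) + ι M * uM * ι r * 0ℚ
          ≡⟨ solve 6 (λ n g i v m r → n :* (g :* i :+ v :* con 0ℚ) :+ m :* v :* r :* con 0ℚ := (i :* (n :* g) :+ v :* con 0ℚ) :+ m :* v :* con 0ℚ) refl (ι n) (G' n) (inv! r) uM (ι M) (ι r) ⟩
        (inv! r * (ι n * G' n) + uM * 0ℚ) + ι M * uM * 0ℚ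
          ≡⟨ cong₂ (λ a z → (inv! r * a + uM * z) + ι M * uM * 0ℚ) IHo (sym (trans B1≡ (cong (λ z → oif z (ΣL m' (λ j → t j * Fs (n ∸ M) (suc j) M (suc r)))) eq))) ⟩
        (inv! r * A1 + uM * B1) + ι M * uM * 0ℚ
          ≡⟨ cong (λ z → (inv! r * A1 + uM * B1) + ι M * uM * oif z (F (n ∸ M) M r)) (sym eq) ⟩
        (inv! r * A1 + uM * B1) + ι M * uM * Fs n M M r
          ≡⟨ sym RHS≡ ⟩
        ΣL M (λ j → t j * Fs n (suc j) M r) ∎
        where open ≡-Reasoning

    large : (M ≤ᵇ n) ≡ true → Stmt (n ∸ M) M (suc r) → Stmt n M r
    large eq IHi = begin
        ι n * F n M r + ι M * uM * ι r * Fs n M M (suc r)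
          ≡⟨ cong (λ z → ι n * F n M r + ι M * uM * ι r * z) (FsT (suc r)) ⟩
        ι n * F n M r + ι M * uM * ι r * F1
          ≡⟨ alg (ι N) (ι M) (ι r) uM (G' n) (G' N) b c (inv! (suc r)) B2
                 (trans (cong ι (sym (ℕP.m∸n+n≡m M≤n))) (ι-+ N M)) (ι-+ 1 r) (sym (inv!-suc r))
                 (FR N m' (suc r)) (trans (FR n m' r) (cong (λ z → G' n * inv! r + uM * z) (FsT (suc r)))) (FR N m' r)
                 (sym IHo) (sub-lem _ B2 (ι M * uM * b) (trans IHi (ΣL-last m' (λ j → t j * Fs N (suc j) M (suc r))))) ⟩
        (inv! r * A1 + uM * B2) + ι M * uM * F N M r
          ≡⟨ cong₂ (λ z w → (inv! r * A1 + uM * z) + ι M * uM * w) (sym (trans B1≡ (cong (λ z → oif z B2) eq))) (sym (FsT r)) ⟩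
        (inv! r * A1 + uM * B1) + ι M * uM * Fs n M M r
          ≡⟨ sym RHS≡ ⟩
        ΣL M (λ j → t j * Fs n (suc j) M r) ∎
      where
      open ≡-Reasoning
      M≤n : M ≤ n
      M≤n = ℕP.≤ᵇ⇒≤ M n (subst Data.Bool.T (sym eq) _)
      N = n ∸ M
      B2 = ΣL m' (λ j → t j * Fs N (suc j) M (suc r))
      F1 = F N M (suc r)
      b = Fs N M M (suc r)
      c = Fs N M M (suc (suc r))
      FsT : ∀ r' → Fs n M M r' ≡ F N M r'
      FsT r' = cong (λ z → oif z (F N M r')) eq

  mutual
    derivativeGeneral : ∀ m n r → Stmt n m r
    derivativeGeneral zero zero r = trans (cong (λ z → ι 0 * z + ι 0 * u 0 * ι r * Fs 0 0 0 (suc r)) (F-zero 0 r))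
                            (solve 4 (λ x v w f → con 0ℚ :* x :+ con 0ℚ :* v :* w :* f := con 0ℚ) refl (inv! r) (u 0) (ι r) (Fs 0 0 0 (suc r)))
    derivativeGeneral zero (suc n) r = trans (cong (λ z → ι (suc n) * z + ι 0 * u 0 * ι r * Fs (suc n) 0 0 (suc r)) (F-suc0 n r))
                            (solve 4 (λ x v w f → x :* con 0ℚ :+ con 0ℚ :* v :* w :* f := con 0ℚ) refl (ι (suc n)) (u 0) (ι r) (Fs (suc n) 0 0 (suc r)))
    derivativeGeneral (suc m') n r = derivativeGeneralK m' n n ℕP.≤-refl r


    derivativeGeneralK : ∀ m' K n → n ≤ K → ∀ r → Stmt n (suc m') r
    derivativeGeneralK m' K n le r = byGuard (suc m' ≤ᵇ n) refl K le
      where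
      byGuard : ∀ b → (suc m' ≤ᵇ n) ≡ b → ∀ K → n ≤ K → Stmt n (suc m') r
      byGuard false eq _ _ = Step.small m' n r (derivativeGeneral m' n 0) eq
      byGuard true eq zero le = ⊥-elim (ℕP.n≮0 (ℕP.≤-trans M≤n le))
        where M≤n = ℕP.≤ᵇ⇒≤ (suc m') n (subst Data.Bool.T (sym eq) _)
      byGuard true eq (suc K') le = Step.large m' n r (derivativeGeneral m' n 0) eq
                                      (derivativeGeneralK m' K' (n ∸ suc m') (∸-bound n m' K' M≤n le) (suc r))
        where M≤n = ℕP.≤ᵇ⇒≤ (suc m') n (subst Data.Bool.T (sym eq) _)


module ExponentialRecursion (u : ℕ → ℚ) where
  open import Data.Rational as ℚ using (ℚ; _+_; _*_; 0ℚ; 1ℚ)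

  open import Data.Nat as ℕ using (ℕ; zero; suc; _∸_; _≤_; _<_; s≤s; _≤ᵇ_)
  import Data.Nat.Properties as ℕP
  open import Data.Bool using (Bool; true; false)
  import Data.Bool
  open import Data.Empty using (⊥-elim)
  open import Data.Rational.Solver
  open import Relation.Binary.PropositionalEquality
  open RationalSums
  open PartitionSums u
  open DerivativeIdentity u

  open +-*-Solver

  -- e n = Σ_{p ⊢ n} Π u(pᵢ) / Π #p(i)!: the coefficients of exp(Σ u(q) xᵠ).
  e : ℕ → ℚ
  e n = F n n 0

  leb-false : ∀ a n → n < a → (a ≤ᵇ n) ≡ false
  leb-false a n lt with a ≤ᵇ n in eq
  ... | true = ⊥-elim (ℕP.<⇒≱ lt (ℕP.≤ᵇ⇒≤ a n (subst Data.Bool.T (sym eq) _)))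
  ... | false = refl

  -- Parts larger than n do not occur: F n m 0 = e n for m ≥ n.
  Fstep : ∀ n m → n ≤ m → F n (suc m) 0 ≡ F n m 0
  Fstep n m le = trans (FR n m 0) (trans (cong (λ z → F n m 0 * 1ℚ + u (suc m) * oif z (F (n ∸ suc m) (suc m) 1)) (leb-false (suc m) n (s≤s le)))
                       (solve 2 (λ x v → x :* con 1ℚ :+ v :* con 0ℚ := x) refl (F n m 0) (u (suc m))))

  Fstab : ∀ n k → F n (k ℕ.+ n) 0 ≡ e n
  Fstab n zero = refl
  Fstab n (suc k) = trans (Fstep n (k ℕ.+ n) (ℕP.m≤n+m n k)) (Fstab n k)

  Fstab' : ∀ n m → n ≤ m → F n m 0 ≡ e n
  Fstab' n m le = trans (cong (λ z → F n z 0) (sym (ℕP.m∸n+n≡m le))) (Fstab n (m ∸ n))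

  derivative : ∀ s → ι (suc s) * e (suc s) ≡ Sp s (λ k l → ι (suc k) * u (suc k) * e l)
  derivative s = begin
    ι (suc s) * e (suc s)
      ≡⟨ solve 4 (λ a x y z → a :* x := a :* x :+ y :* con 0ℚ :* z) refl (ι (suc s)) (e (suc s)) (ι (suc s) * u (suc s)) (Fs (suc s) (suc s) (suc s) 1) ⟩
    ι (suc s) * e (suc s) + ι (suc s) * u (suc s) * ι 0 * Fs (suc s) (suc s) (suc s) 1
      ≡⟨ derivativeGeneral (suc s) (suc s) 0 ⟩
    ΣL (suc s) (λ j → ι (suc j) * u (suc j) * Fs (suc s) (suc j) (suc s) 0)
      ≡⟨ ΣL-cong (suc s) (λ j lt → cong (ι (suc j) * u (suc j) *_) (trans (cong (λ z → oif z (F (s ∸ j) (suc s) 0)) (lebT j s (ℕP.≤-pred lt))) (Fstab' (s ∸ j) (suc s) (ℕP.≤-trans (ℕP.m∸n≤m s j) (ℕP.n≤1+n s))))) ⟩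
    ΣL (suc s) (λ j → ι (suc j) * u (suc j) * e (s ∸ j))
      ≡⟨ sym (Sp-ΣL s (λ k l → ι (suc k) * u (suc k) * e l)) ⟩
    Sp s (λ k l → ι (suc k) * u (suc k) * e l) ∎
    where
    open ≡-Reasoning
    lebT : ∀ j s → j ≤ s → (suc j ≤ᵇ suc s) ≡ true
    lebT zero s _ = refl
    lebT (suc j) (suc s) (s≤s le) = lebT j s le


module ClosedForm (c' : ℕ) (a : Fin (suc c')) where
  open import Data.Nat using (ℕ; zero; suc; _+_; _*_; _^_; _≤_; s≤s; _!)
  open import Data.Fin using (Fin; zero; suc)

  import Data.Nat as ℕ
  import Data.Nat.Properties as ℕP
  import Data.Rational.Properties as ℚP
  open import Data.Nat.Tactic.RingSolver using (solve-∀)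
  open import Data.Nat.Combinatorics using (_C_; nC1≡n; nCk+nC[k+1]≡[n+1]C[k+1])
  open import Data.Rational as ℚ using (ℚ; 1ℚ)
  open import Data.Rational.Solver
  open import Data.List using ([]; _∷_; map; upTo)
  open import Relation.Binary.PropositionalEquality
  open import Defs using (inv!; innerSum; rhs; multinomial; mult; prodℚ; partitions; ℕtoℚ)
  open Convolution
  open RationalSums
  open Colourings c' a using (atMost)
  open BlockRecursion c' a using (avoiders; avoiders-rec)

  u : ℕ → ℚ
  u q = ι (atMost q 2) ℚ.* inv! q

  open PartitionSums u
  open DerivativeIdentity u
  open ExponentialRecursion u

  module QS = +-*-Solver

  atMost0 : ∀ q → atMost q 0 ≡ c' ^ q
  atMost0 zero = refl
  atMost0 (suc q) = cong (c' *_) (atMost0 q)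

  atMost1 : ∀ q → atMost (suc q) 1 ≡ c' ^ suc q + suc q * c' ^ q
  atMost1 zero = l c'
    where l : ∀ d → 1 + d * 1 ≡ d * 1 + 1 * 1
          l = solve-∀
  atMost1 (suc q) = trans (cong₂ (λ x y → x + c' * y) (atMost0 (suc q)) (atMost1 q)) (l c' (c' ^ q) q)
    where l : ∀ d X q → d * X + d * (d * X + suc q * X) ≡ d * (d * X) + suc (suc q) * (d * X)
          l = solve-∀

  atMost2 : ∀ p → atMost (suc (suc p)) 2 ≡ c' ^ suc (suc p) + suc (suc p) * c' ^ suc p + (suc (suc p) C 2) * c' ^ p
  atMost2 zero = l c'
    where l : ∀ d → (1 + d * 1) + d * (1 + d * 1) ≡ d * (d * 1) + 2 * (d * 1) + 1 * 1
          l = solve-∀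
  atMost2 (suc p) = begin
    atMost (suc (suc p)) 1 + c' * atMost (suc (suc p)) 2
      ≡⟨ cong₂ (λ x y → x + c' * y) (atMost1 (suc p)) (atMost2 p) ⟩
    (c' ^ suc (suc p) + suc (suc p) * c' ^ suc p) + c' * (c' ^ suc (suc p) + suc (suc p) * c' ^ suc p + K * c' ^ p)
      ≡⟨ l c' (c' ^ p) p K ⟩
    c' ^ suc (suc (suc p)) + suc (suc (suc p)) * c' ^ suc (suc p) + (suc (suc p) + K) * c' ^ suc p
      ≡⟨ cong (λ z → c' ^ suc (suc (suc p)) + suc (suc (suc p)) * c' ^ suc (suc p) + z * c' ^ suc p) kk ⟩
    c' ^ suc (suc (suc p)) + suc (suc (suc p)) * c' ^ suc (suc p) + (suc (suc (suc p)) C 2) * c' ^ suc p ∎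
    where
    open ≡-Reasoning
    K = suc (suc p) C 2
    kk : suc (suc p) + K ≡ suc (suc (suc p)) C 2
    kk = trans (cong (_+ K) (sym (nC1≡n (suc (suc p))))) (nCk+nC[k+1]≡[n+1]C[k+1] (suc (suc p)) 1)
    l : ∀ d X p K → (d * (d * X) + suc (suc p) * (d * X)) + d * (d * (d * X) + suc (suc p) * (d * X) + K * X)
                  ≡ d * (d * (d * X)) + suc (suc (suc p)) * (d * (d * X)) + (suc (suc p) + K) * (d * X)
    l = solve-∀

  atMost≡inner : ∀ q → atMost q 2 ≡ innerSum (suc c') q
  atMost≡inner zero = refl
  atMost≡inner (suc zero) = l c'
    where l : ∀ d → 1 + d * 1 ≡ 1 * (d * 1) + (1 + 0)
          l = solve-∀
  atMost≡inner (suc (suc p)) = trans (atMost2 p) (l (c' ^ suc (suc p)) (c' ^ suc p) (c' ^ p) ((suc (suc p)) C 2) (sym (nC1≡n (suc (suc p)))))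
    where
    l : ∀ A B D K → {m : ℕ} → suc (suc p) ≡ m → A + suc (suc p) * B + K * D ≡ 1 * A + (m * B + (K * D + 0))
    l A B D K refl = l' A B D K (suc (suc p))
      where l' : ∀ A B D K m → A + m * B + K * D ≡ 1 * A + (m * B + (K * D + 0))
            l' = solve-∀

  open QS using (solve; _:+_; _:*_; _:=_; con)

  alg2 : ∀ is i1 im w f em → im ℚ.* f ≡ 1ℚ → ((is ℚ.* i1) ℚ.* im) ℚ.* (w ℚ.* (f ℚ.* em)) ≡ is ℚ.* (w ℚ.* i1) ℚ.* em
  alg2 is i1 im w f em h = trans (solve 6 (λ is i1 im w f em → ((is :* i1) :* im) :* (w :* (f :* em)) := (is :* (w :* i1) :* em) :* (im :* f)) refl is i1 im w f em)
    (trans (cong ((is ℚ.* (w ℚ.* i1) ℚ.* em) ℚ.*_) h) (solve 1 (λ x → x :* con 1ℚ := x) refl (is ℚ.* (w ℚ.* i1) ℚ.* em)))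

  -- avoiders l = l! · e l, by comparing the block recursion with `derivative`.
  avoiders≡ : ∀ s l → l ≤ s → ι (avoiders l) ≡ ι (l !) ℚ.* e l
  avoiders≡ s zero _ = trans (solve 1 (λ x → x := con 1ℚ :* x) refl 1ℚ) (cong (1ℚ ℚ.*_) (sym (F-zero 0 0)))
  avoiders≡ (suc s) (suc l) (s≤s le) = begin
    ι (avoiders (suc l))
      ≡⟨ cong ι (avoiders-rec l) ⟩
    ι (binConv l (λ k m → atMost (suc k) 2 * avoiders m))
      ≡⟨ binConv-exponential l (λ k m → atMost (suc k) 2 * avoiders m) ⟩
    ι (l !) ℚ.* Hs l (λ k m → atMost (suc k) 2 * avoiders m)
      ≡⟨ cong (ι (l !) ℚ.*_) (Sp-cong l pt) ⟩
    ι (l !) ℚ.* Sp l (λ k m → ι (suc k) ℚ.* u (suc k) ℚ.* e m)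
      ≡⟨ cong (ι (l !) ℚ.*_) (sym (derivative l)) ⟩
    ι (l !) ℚ.* (ι (suc l) ℚ.* e (suc l))
      ≡⟨ solve 3 (λ a b x → a :* (b :* x) := (b :* a) :* x) refl (ι (l !)) (ι (suc l)) (e (suc l)) ⟩
    (ι (suc l) ℚ.* ι (l !)) ℚ.* e (suc l)
      ≡⟨ cong (ℚ._* e (suc l)) (sym (ι-* (suc l) (l !))) ⟩
    ι (suc l !) ℚ.* e (suc l) ∎
    where
    open ≡-Reasoning
    pt : ∀ k m → k + m ≡ l → (inv! k ℚ.* inv! m) ℚ.* ι (atMost (suc k) 2 * avoiders m) ≡ ι (suc k) ℚ.* u (suc k) ℚ.* e m
    pt k m eq = begin
      (inv! k ℚ.* inv! m) ℚ.* ι (atMost (suc k) 2 * avoiders m)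
        ≡⟨ cong₂ (λ x y → (x ℚ.* inv! m) ℚ.* y) (sym (inv!-suc k)) (trans (ι-* (atMost (suc k) 2) (avoiders m)) (cong (ι (atMost (suc k) 2) ℚ.*_) (avoiders≡ s m (ℕP.≤-trans (subst (m ≤_) eq (ℕP.m≤n+m m k)) le)))) ⟩
      ((ι (suc k) ℚ.* inv! (suc k)) ℚ.* inv! m) ℚ.* (ι (atMost (suc k) 2) ℚ.* (ι (m !) ℚ.* e m))
        ≡⟨ alg2 (ι (suc k)) (inv! (suc k)) (inv! m) (ι (atMost (suc k) 2)) (ι (m !)) (e m) (trans (ℚP.*-comm (inv! m) (ι (m !))) (ι-inv m)) ⟩
      ι (suc k) ℚ.* u (suc k) ℚ.* e m ∎

  prodU : ∀ p → U p ≡ prodℚ (map inv! p) ℚ.* prodℚ (map (λ q → ι (innerSum (suc c') q)) p)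
  prodU [] = refl
  prodU (q ∷ p) = trans (cong₂ (λ x y → (ι x ℚ.* inv! q) ℚ.* y) (atMost≡inner q) (prodU p))
    (solve 4 (λ w i a b → (w :* i) :* (a :* b) := (i :* a) :* (w :* b)) refl (ι (innerSum (suc c') q)) (inv! q) (prodℚ (map inv! p)) (prodℚ (map (λ q → ι (innerSum (suc c') q)) p)))

  rhs≡ : ∀ k → rhs (suc k) (suc c') ≡ ι (suc k !) ℚ.* e (suc k)
  rhs≡ k = trans (sum-cong' (partitions (suc k)) termEq) (sum-scalˡ (W (suc k) 0) (ι (suc k !)) (partitions (suc k)))
    where
    n = suc k
    termEq : ∀ p → multinomial n p ℚ.* prodℚ (map (λ i → inv! (mult p i)) (map suc (upTo n))) ℚ.* prodℚ (map (λ q → ℕtoℚ (innerSum (suc c') q)) p)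
                 ≡ ι (n !) ℚ.* W n 0 p
    termEq p = begin
      (ι (n !) ℚ.* PI) ℚ.* Pm n p ℚ.* PW
        ≡⟨ cong (λ z → (ι (n !) ℚ.* PI) ℚ.* z ℚ.* PW) (Pm-last k p) ⟩
      (ι (n !) ℚ.* PI) ℚ.* (Pm k p ℚ.* inv! (mult p n)) ℚ.* PW
        ≡⟨ solve 5 (λ f a b c d → (f :* a) :* (b :* c) :* d := f :* ((a :* d) :* (b :* c))) refl (ι (n !)) PI (Pm k p) (inv! (mult p n)) PW ⟩
      ι (n !) ℚ.* ((PI ℚ.* PW) ℚ.* (Pm k p ℚ.* inv! (mult p n)))
        ≡⟨ cong₂ (λ x y → ι (n !) ℚ.* (x ℚ.* (Pm k p ℚ.* inv! y))) (sym (prodU p)) (sym (ℕP.+-identityʳ (mult p n))) ⟩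
      ι (n !) ℚ.* W n 0 p ∎
      where
      open ≡-Reasoning
      PI = prodℚ (map inv! p)
      PW = prodℚ (map (λ q → ι (innerSum (suc c') q)) p)

  final : ∀ k → ℕtoℚ (avoiders (suc k)) ≡ rhs (suc k) (suc c')
  final k = trans (avoiders≡ (suc k) (suc k) ℕP.≤-refl) (sym (rhs≡ k))


-- The theorem: N = countAvoiding (full mask) enumerates the avoiding
-- coloured partitions, and N equals the partition sum of the statement.
-- (The hypotheses exclude the degenerate cases n = 0 and c = 0.)
corollary5p2 : (n c : ℕ) (a : Fin c) → 3 ≤ n → 1 ≤ c →
    Σ ℕ (λ N → (AvoidEq111 n c a ↔ Fin N) × (ℕtoℚ N ≡ rhs n c))
corollary5p2 zero c a () _
corollary5p2 (suc k) zero () _ _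
corollary5p2 (suc k) (suc c') a _ _ = N , enumeration , value
  where
  open Enumeration c' a using (allT; iso; countAvoiding≡avoiders)
  N : ℕ
  N = BlockRecursion.countAvoiding c' a (suc k) (allT (suc k))
  enumeration : AvoidEq111 (suc k) (suc c') a ↔ Fin N
  enumeration = iso (suc k)
  value : ℕtoℚ N ≡ rhs (suc k) (suc c')
  value = trans (cong ℕtoℚ (countAvoiding≡avoiders (suc k))) (ClosedForm.final c' a k)
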